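{- For all integers $s,t>0$, let $K_{s,t}$ be the complete bipartite graph with parts of sizes $s$ and $t$. Then $\mathcal{H}^{\mathrm{Path}}_n(K_{s,t})\cong\mathcal{H}^{\mathrm{Cube}}_n(K_{s,t})\cong(0)$ for all $n>0$.
   Context: $R$ is a commutative ring with unit; graphs are finite, simple and undirected. A graph homomorphism is a vertex map sending adjacent vertices to equal or adjacent vertices. $Q_n$ is the graph on $\{0,1\}^n$ with edges between vertices at Hamming distance one ($Q_0$ a single vertex). Discrete cubical homology $\mathcal{H}^{\mathrm{Cube}}_\bullet(G)$: a singular $n$-cube is a graph homomorphism $\sigma: Q_n\to G$; $\mathcal{L}^{\mathrm{Cube}}_n(G)$ is the free $R$-module on them. For $n\ge1$, $i\in[n]$: $f_i^{\pm}\sigma(a_1,\dots,a_{n-1})=\sigma(a_1,\dots,a_{i-1},\epsilon,a_i,\dots,a_{n-1})$ with $\epsilon=1$ for $+$, $\epsilon=0$ for $-$. $\sigma$ is degenerate if $f_i^+\sigma=f_i^-\sigma$ for some $i$. $\mathcal{C}^{\mathrm{Cube}}_n(G)$ is $\mathcal{L}^{\mathrm{Cube}}_n(G)$ modulo degenerate cubes, with $\partial_n\sigma=\sum_{i=1}^n(-1)^i(f_i^-\sigma-f_i^+\sigma)$, $\partial_0=0$; $\mathcal{H}^{\mathrm{Cube}}_n(G)$ is its homology. Path homology $\mathcal{H}^{\mathrm{Path}}_\bullet(G)$: $\mathcal{C}_n(V)$ is the free $R$-module on $(n+1)$-tuples of vertices modulo tuples with $v_i=v_{i+1}$ for some $i$,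 with $\partial_n(v_0,\dots,v_n)=\sum_{i=0}^n(-1)^i(v_0,\dots,\widehat{v_i},\dots,v_n)$, $\partial_0=0$. $\widetilde{\mathcal{C}}_n(G)\subseteq\mathcal{C}_n(V)$ is generated by allowed paths (tuples with $\{v_i,v_{i+1}\}\in E(G)$ for all $i$), $\widetilde{\mathcal{C}}_{ -1}=0$; $\mathcal{C}^{\mathrm{Path}}_n(G)=\{x\in\widetilde{\mathcal{C}}_n(G):\partial_nx\in\widetilde{\mathcal{C}}_{n-1}(G)\}$ and $\mathcal{H}^{\mathrm{Path}}_n(G)$ is its homology. -}

module Defs where

open import Level using (Level)
open import Algebra.Bundles using (CommutativeRing)
open import Data.Nat using (ℕ; zero; suc)
open import Data.Fin as Fin using (Fin; toℕ)
open import Data.Bool using (Bool; true; false; if_then_else_)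
open import Data.Vec using (Vec; []; _∷_; insertAt; removeAt)
import Data.Vec.Properties as VecP
import Data.Sum.Properties as SumP
open import Data.List using (List; []; _∷_; _++_; map; concatMap; concat)
open import Data.List.Relation.Unary.All using (All)
open import Data.Product using (Σ; ∃; ∃-syntax; _×_; _,_; proj₁; proj₂)
open import Data.Sum using (_⊎_; inj₁; inj₂)
open import Data.Unit using (⊤)
open import Data.Unit.Polymorphic using () renaming (⊤ to ⊤ₚ)
open import Data.Empty using (⊥)
open import Relation.Nullary using (Dec; yes; no; does; ¬_)
open import Relation.Binary using (Decidable; DecidableEquality)
open import Relation.Binary.PropositionalEquality using (_≡_; _≢_; refl; cong)

record Graph : Set₁ where
  field
    V   : Set
    _≟_ : DecidableEquality V
    E   : V → V → Set

KE : ∀ {s t} → (Fin s ⊎ Fin t) → (Fin s ⊎ Fin t) → Set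
KE (inj₁ _) (inj₂ _) = ⊤
KE (inj₂ _) (inj₁ _) = ⊤
KE (inj₁ _) (inj₁ _) = ⊥
KE (inj₂ _) (inj₂ _) = ⊥

K : ℕ → ℕ → Graph
K s t = record { V = Fin s ⊎ Fin t ; _≟_ = SumP.≡-dec Fin._≟_ Fin._≟_ ; E = KE }

data QAdj : {n : ℕ} → Vec Bool n → Vec Bool n → Set where
  here  : ∀ {n x y} {a : Vec Bool n} → x ≢ y → QAdj (x ∷ a) (y ∷ a)
  there : ∀ {n x} {a b : Vec Bool n} → QAdj a b → QAdj (x ∷ a) (x ∷ b)

insert-QAdj : ∀ {n} (i : Fin (suc n)) (e : Bool) {a b : Vec Bool n} →
              QAdj a b → QAdj (insertAt a i e) (insertAt b i e)
insert-QAdj Fin.zero    e p         = there p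
insert-QAdj (Fin.suc i) e (here q)  = here q
insert-QAdj (Fin.suc i) e (there p) = there (insert-QAdj i e p)

decPointwise : ∀ {A : Set} → DecidableEquality A → (n : ℕ) →
               (f g : Vec Bool n → A) → Dec (∀ a → f a ≡ g a)
decPointwise _≟_ zero f g with f [] ≟ g []
... | yes p = yes λ { [] → p }
... | no ¬p = no λ h → ¬p (h [])
decPointwise _≟_ (suc n) f g
  with decPointwise _≟_ n (λ a → f (true ∷ a)) (λ a → g (true ∷ a))
     | decPointwise _≟_ n (λ a → f (false ∷ a)) (λ a → g (false ∷ a))
... | yes p | yes q = yes λ { (true ∷ a) → p a ; (false ∷ a) → q a }
... | no ¬p | _     = no λ h → ¬p (λ a → h (true ∷ a))
... | yes _ | no ¬q = no λ h → ¬q (λ a → h (false ∷ a))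

-- Free R-modules on a set of generators G, as finite formal sums
-- (lists of coefficient/generator pairs).  Two formal sums are equal when
-- all their coefficients agree (generators compared by a decidable
-- equivalence _∼_ , e.g. ≡ or pointwise equality of maps).

module FreeModule {c ℓ : Level} (R : CommutativeRing c ℓ) where
  open CommutativeRing R

  Chain : Set → Set c
  Chain G = List (Carrier × G)

  coeff : {G : Set} {_∼_ : G → G → Set} → Decidable _∼_ → Chain G → G → Carrier
  coeff dec []            g = 0#
  coeff dec ((r , h) ∷ x) g = (if does (dec h g) then r else 0#) + coeff dec x g

  EqIn : {G : Set} {_∼_ : G → G → Set} → Decidable _∼_ → Chain G → Chain G → Set ℓ
  EqIn dec x y = ∀ g → coeff dec x g ≈ coeff dec y g

  _⊕_ : {G : Set} → Chain G → Chain G → Chain G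
  x ⊕ y = x ++ y

  scale : {G : Set} → Carrier → Chain G → Chain G
  scale r = map (λ p → (r * proj₁ p , proj₂ p))

  lin : {G H : Set} → (G → Chain H) → Chain G → Chain H
  lin f = concatMap (λ p → scale (proj₁ p) (f (proj₂ p)))

  InSpan : {G : Set} → (G → Set) → Chain G → Set c
  InSpan P x = All (λ p → P (proj₂ p)) x

  sgn : ℕ → Carrier
  sgn zero    = 1#
  sgn (suc k) = - sgn k

module Cubical {c ℓ : Level} (R : CommutativeRing c ℓ) (G : Graph) where
  open CommutativeRing R
  open FreeModule R
  open Graph G

  record Cube (n : ℕ) : Set where
    constructor cube
    field
      σ   : Vec Bool n → V
      hom : ∀ {a b} → QAdj a b → σ a ≡ σ b ⊎ E (σ a) (σ b)
  open Cube public

  _∼_ : ∀ {n} → Cube n → Cube n → Set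
  κ ∼ τ = ∀ a → σ κ a ≡ σ τ a

  _∼?_ : ∀ {n} → Decidable (_∼_ {n})
  _∼?_ {n} κ τ = decPointwise _≟_ n (σ κ) (σ τ)

  -- face f_i^ε (i is 0-based here: Fin.zero is the paper's i = 1)
  face : ∀ {n} → Fin (suc n) → Bool → Cube (suc n) → Cube n
  face i e κ = cube (λ a → σ κ (insertAt a i e))
                    (λ p → hom κ (insert-QAdj i e p))

  Degenerate : ∀ {n} → Cube n → Set
  Degenerate {zero}  κ = ⊥
  Degenerate {suc n} κ = ∃[ i ] (face i true κ ∼ face i false κ)

  CChain : ℕ → Set c
  CChain n = Chain (Cube n)

  _≈C_ : ∀ {n} → CChain n → CChain n → Set ℓ
  _≈C_ = EqIn _∼?_

  ∂gen : ∀ {n} → Cube (suc n) → CChain n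
  ∂gen {n} κ = concat (Data.List.map term (Data.List.allFin (suc n)))
    where
      term : Fin (suc n) → CChain n
      term i = (sgn (suc (toℕ i)) , face i false κ)
             ∷ (- sgn (suc (toℕ i)) , face i true κ) ∷ []

  ∂ : ∀ {n} → CChain (suc n) → CChain n
  ∂ = lin ∂gen

  -- z represents a cycle of C^Cube_n(G) = L_n / D_n
  IsCycle : (n : ℕ) → CChain n → Set (c Level.⊔ ℓ)
  IsCycle zero    z = ⊤ₚ
  IsCycle (suc n) z = ∃[ d ] (InSpan Degenerate d × (∂ z ≈C d))

  CubeHomologyVanishes : ℕ → Set (c Level.⊔ ℓ)
  CubeHomologyVanishes n =
    (z : CChain n) → IsCycle n z →
    ∃[ w ] ∃[ d ] (InSpan Degenerate d × (z ≈C (∂ w ⊕ d)))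

module PathH {c ℓ : Level} (R : CommutativeRing c ℓ) (G : Graph) where
  open CommutativeRing R
  open FreeModule R
  open Graph G

  Tup : ℕ → Set
  Tup n = Vec V (suc n)

  PChain : ℕ → Set c
  PChain n = Chain (Tup n)

  -- tuples with v_i = v_{i+1} for some i (these are zero in C_n(V))
  NonRegular : ∀ {m} → Vec V m → Set
  NonRegular []            = ⊥
  NonRegular (x ∷ [])      = ⊥
  NonRegular (x ∷ y ∷ xs)  = x ≡ y ⊎ NonRegular (y ∷ xs)

  Allowed : ∀ {m} → Vec V m → Set
  Allowed []            = ⊤
  Allowed (x ∷ [])      = ⊤
  Allowed (x ∷ y ∷ xs)  = E x y × Allowed (y ∷ xs)

  _≈F_ : ∀ {n} → PChain n → PChain n → Set ℓ
  _≈F_ = EqIn (VecP.≡-dec _≟_)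

  -- equality in C_n(V) = free module modulo non-regular tuples
  _≈V_ : ∀ {n} → PChain n → PChain n → Set (c Level.⊔ ℓ)
  x ≈V y = ∃[ d ] (InSpan NonRegular d × (x ≈F (y ⊕ d)))

  ∂gen : ∀ {n} → Tup (suc n) → PChain n
  ∂gen {n} v = Data.List.map (λ i → (sgn (toℕ i) , removeAt v i))
                             (Data.List.allFin (suc (suc n)))

  ∂ : ∀ {n} → PChain (suc n) → PChain n
  ∂ = lin ∂gen

  -- membership in  C̃_n(G)  (span of allowed paths inside C_n(V))
  InÃ : ∀ {n} → PChain n → Set (c Level.⊔ ℓ)
  InÃ x = ∃[ a ] (InSpan Allowed a × (x ≈V a))

  InCPath : (n : ℕ) → PChain n → Set (c Level.⊔ ℓ)
  InCPath zero    x = InÃ x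
  InCPath (suc n) x = InÃ x × InÃ (∂ x)

  IsCycle : (n : ℕ) → PChain n → Set (c Level.⊔ ℓ)
  IsCycle zero    x = ⊤ₚ
  IsCycle (suc n) x = ∂ x ≈V []

  PathHomologyVanishes : ℕ → Set (c Level.⊔ ℓ)
  PathHomologyVanishes n =
    (x : PChain n) → InCPath n x → IsCycle n x →
    ∃[ w ] (InCPath (suc n) w × (∂ w ≈V x))

{-
K_{s,t} with s, t > 0 is contractible in two steps. Fix adjacent vertices a₀ and b₀ and let fold
fix them, send the other vertices of a₀'s side to b₀ and those of b₀'s side to a₀. Every vertex is
equal or adjacent to its image, and any map into the edge a₀b₀ is a graph homomorphism, so
id ≃ fold ≃ const a₀ through one-step homotopies.

A one-step homotopy between f and g yields a prism operator h with ∂h + h∂ = f♯ − g♯: on cubes h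
adds a coordinate running from g to f, on paths h(x u) = g(x)·(f(x u) − h(u)). The operator h
preserves degenerate cubes and non-regular tuples, and sends allowed paths to allowed or non-regular
ones, so for every cycle z the chains f♯z and g♯z differ by the boundary of h z modulo degenerate
elements, and h z lies in C^Path when z does. Along id ≃ fold ≃ const a₀ this makes z homologous to
const♯z, which in positive degree is degenerate (resp. non-regular), hence zero.
-}
module Submission where

open import Defs
open import Level using (Level; 0ℓ; _⊔_)
open import Algebra.Bundles using (CommutativeRing)
open import Data.Bool using (Bool; true; false; if_then_else_)
open import Data.Empty using (⊥-elim)
open import Data.List as List using (List; []; _∷_; length; concat; tabulate; allFin)
open import Data.List.Properties using (map-++; map-tabulate; ++-assoc)
open import Data.List.Relation.Unary.All as All using (All; []; _∷_)
open import Data.List.Relation.Unary.All.Properties using (++⁺; map⁺)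
open import Data.Fin using (Fin; toℕ; zero; suc)
open import Data.Nat using (ℕ; zero; suc; _≤_; _<_; z≤n; s≤s)
open import Data.Nat.Properties using (≤-refl; ≤-trans; m≤n⇒m≤1+n)
open import Data.Vec as Vec using (Vec; []; _∷_; removeAt)
import Data.Vec.Properties as VecP
open import Data.Product using (_×_; _,_; proj₁; proj₂; ∃-syntax)
open import Data.Sum using (_⊎_; inj₁; inj₂)
open import Data.Unit using (tt)
open import Function using (_∘_)
open import Relation.Binary.Bundles using (DecSetoid; Setoid)
open import Relation.Binary.Definitions using (Symmetric)
open import Relation.Binary.PropositionalEquality as ≡ using (_≡_)
import Relation.Binary.Reasoning.Setoid as SetoidReasoning
open import Relation.Nullary using (yes; no; does; ¬_)

module LinearCombinations {c ℓ : Level} (R : CommutativeRing c ℓ) where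
  open CommutativeRing R hiding (zero)
  open FreeModule R
  open import Algebra.Properties.CommutativeSemigroup +-commutativeSemigroup
    using () renaming (interchange to +-interchange; x∙yz≈y∙xz to x+[y+z]≈y+[x+z])
  open import Algebra.Properties.Ring ring using (-1*x≈-x; -0#≈0#; -‿distribʳ-*; -‿+-comm; -‿involutive)
  open import Algebra.Properties.Group +-group using (x∙y⁻¹≈ε⇒x≈y)

  neg : {G : Set} → Chain G → Chain G
  neg = scale (- 1#)

  relabel : {G H : Set} → (G → H) → Chain G → Chain H
  relabel h = lin (λ σ → (1# , h σ) ∷ [])

  pairing : {G : Set} → Chain G → (G → Carrier) → Carrier
  pairing []            φ = 0#
  pairing ((r , σ) ∷ x) φ = r * φ σ + pairing x φ

  module _ {G : Set} where
    open SetoidReasoning setoid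

    pairing-⊕ : (x y : Chain G) (φ : G → Carrier) → pairing (x ⊕ y) φ ≈ pairing x φ + pairing y φ
    pairing-⊕ []            y φ = sym (+-identityˡ _)
    pairing-⊕ ((r , σ) ∷ x) y φ = trans (+-congˡ (pairing-⊕ x y φ)) (sym (+-assoc _ _ _))

    pairing-scale : (s : Carrier) (x : Chain G) (φ : G → Carrier) → pairing (scale s x) φ ≈ s * pairing x φ
    pairing-scale s []            φ = sym (zeroʳ s)
    pairing-scale s ((r , σ) ∷ x) φ =
      trans (+-cong (*-assoc s r (φ σ)) (pairing-scale s x φ)) (sym (distribˡ s _ _))

    pairing-cong : (x : Chain G) {φ ψ : G → Carrier} → (∀ σ → φ σ ≈ ψ σ) → pairing x φ ≈ pairing x ψ
    pairing-cong []            φ≈ψ = refl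
    pairing-cong ((r , σ) ∷ x) φ≈ψ = +-cong (*-congˡ (φ≈ψ σ)) (pairing-cong x φ≈ψ)

    pairing-+ : (x : Chain G) (φ ψ : G → Carrier) → pairing x (λ σ → φ σ + ψ σ) ≈ pairing x φ + pairing x ψ
    pairing-+ []            φ ψ = sym (+-identityˡ 0#)
    pairing-+ ((r , σ) ∷ x) φ ψ = begin
      r * (φ σ + ψ σ) + pairing x (λ σ → φ σ + ψ σ)   ≈⟨ +-cong (distribˡ r _ _) (pairing-+ x φ ψ) ⟩
      (r * φ σ + r * ψ σ) + (pairing x φ + pairing x ψ) ≈⟨ +-interchange _ _ _ _ ⟩
      (r * φ σ + pairing x φ) + (r * ψ σ + pairing x ψ) ∎

    pairing-neg : (x : Chain G) (φ : G → Carrier) → pairing x (λ σ → - φ σ) ≈ - pairing x φ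
    pairing-neg []            φ = sym -0#≈0#
    pairing-neg ((r , σ) ∷ x) φ = begin
      r * - φ σ + pairing x (λ σ → - φ σ)   ≈⟨ +-cong (-‿distribʳ-* r (φ σ)) (sym (pairing-neg x φ)) ⟨
      - (r * φ σ) + - pairing x φ           ≈⟨ -‿+-comm _ _ ⟩
      - (r * φ σ + pairing x φ)             ∎

  pairing-lin : {G H : Set} (F : G → Chain H) (x : Chain G) (φ : H → Carrier) →
                pairing (lin F x) φ ≈ pairing x (λ σ → pairing (F σ) φ)
  pairing-lin F []            φ = refl
  pairing-lin F ((r , σ) ∷ x) φ =
    trans (pairing-⊕ (scale r (F σ)) (lin F x) φ) (+-cong (pairing-scale r (F σ) φ) (pairing-lin F x φ))

  module Coefficients (S : DecSetoid 0ℓ 0ℓ) where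
    open DecSetoid S public using () renaming (Carrier to Gen; _≈_ to _∼_; _≟_ to _∼?_)
    open DecSetoid S using () renaming (refl to ∼-refl; sym to ∼-sym; trans to ∼-trans)
    open SetoidReasoning setoid

    ⟦_⟧ : Chain Gen → Gen → Carrier
    ⟦_⟧ = coeff _∼?_

    δ : Gen → Gen → Carrier
    δ g h = if does (h ∼? g) then 1# else 0#

    coeff≈pairing-δ : (x : Chain Gen) (g : Gen) → ⟦ x ⟧ g ≈ pairing x (δ g)
    coeff≈pairing-δ []            g = refl
    coeff≈pairing-δ ((r , h) ∷ x) g = +-cong (selected (does (h ∼? g))) (coeff≈pairing-δ x g)
      where
      selected : ∀ b → (if b then r else 0#) ≈ r * (if b then 1# else 0#)
      selected true  = sym (*-identityʳ r)
      selected false = sym (zeroʳ r)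

    coeff-⊕ : (x y : Chain Gen) (g : Gen) → ⟦ x ⊕ y ⟧ g ≈ ⟦ x ⟧ g + ⟦ y ⟧ g
    coeff-⊕ x y g = begin
      ⟦ x ⊕ y ⟧ g                          ≈⟨ coeff≈pairing-δ (x ⊕ y) g ⟩
      pairing (x ⊕ y) (δ g)                 ≈⟨ pairing-⊕ x y (δ g) ⟩
      pairing x (δ g) + pairing y (δ g)     ≈⟨ +-cong (coeff≈pairing-δ x g) (coeff≈pairing-δ y g) ⟨
      ⟦ x ⟧ g + ⟦ y ⟧ g                    ∎

    coeff-scale : (s : Carrier) (x : Chain Gen) (g : Gen) → ⟦ scale s x ⟧ g ≈ s * ⟦ x ⟧ g
    coeff-scale s x g = begin
      ⟦ scale s x ⟧ g             ≈⟨ coeff≈pairing-δ (scale s x) g ⟩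
      pairing (scale s x) (δ g)   ≈⟨ pairing-scale s x (δ g) ⟩
      s * pairing x (δ g)         ≈⟨ *-congˡ (coeff≈pairing-δ x g) ⟨
      s * ⟦ x ⟧ g                ∎

    coeff-neg : (x : Chain Gen) (g : Gen) → ⟦ neg x ⟧ g ≈ - ⟦ x ⟧ g
    coeff-neg x g = trans (coeff-scale (- 1#) x g) (-1*x≈-x _)

    coeff-lin : {G : Set} (F : G → Chain Gen) (x : Chain G) (g : Gen) →
                ⟦ lin F x ⟧ g ≈ pairing x (λ σ → ⟦ F σ ⟧ g)
    coeff-lin F x g = begin
      ⟦ lin F x ⟧ g                             ≈⟨ coeff≈pairing-δ (lin F x) g ⟩
      pairing (lin F x) (δ g)                   ≈⟨ pairing-lin F x (δ g) ⟩
      pairing x (λ σ → pairing (F σ) (δ g))     ≈⟨ pairing-cong x (λ σ → coeff≈pairing-δ (F σ) g) ⟨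
      pairing x (λ σ → ⟦ F σ ⟧ g)               ∎

    coeff-cons-∼ : ∀ {r h g} (x : Chain Gen) → h ∼ g → ⟦ (r , h) ∷ x ⟧ g ≈ r + ⟦ x ⟧ g
    coeff-cons-∼ {h = h} {g} x h∼g with h ∼? g
    ... | yes _    = refl
    ... | no h≁g   = ⊥-elim (h≁g h∼g)

    coeff-cons-≁ : ∀ {r h g} (x : Chain Gen) → ¬ h ∼ g → ⟦ (r , h) ∷ x ⟧ g ≈ ⟦ x ⟧ g
    coeff-cons-≁ {h = h} {g} x h≁g with h ∼? g
    ... | yes h∼g = ⊥-elim (h≁g h∼g)
    ... | no _    = +-identityˡ _

    infix 4 _≋_
    record _≋_ (x y : Chain Gen) : Set ℓ where
      constructor coeffwise
      field coeff-≈ : EqIn _∼?_ x y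
    open _≋_ public

    ≋-refl : ∀ {x} → x ≋ x
    ≋-refl = coeffwise λ g → refl

    ≋-sym : ∀ {x y} → x ≋ y → y ≋ x
    ≋-sym x≋y = coeffwise λ g → sym (coeff-≈ x≋y g)

    ≋-trans : ∀ {x y z} → x ≋ y → y ≋ z → x ≋ z
    ≋-trans x≋y y≋z = coeffwise λ g → trans (coeff-≈ x≋y g) (coeff-≈ y≋z g)

    ≋-setoid : Setoid c ℓ
    ≋-setoid = record
      { Carrier       = Chain Gen
      ; _≈_           = _≋_
      ; isEquivalence = record { refl = ≋-refl ; sym = ≋-sym ; trans = ≋-trans }
      }

    module ≋-Reasoning = SetoidReasoning ≋-setoid

    ⊕-cong : ∀ {x x′ y y′} → x ≋ x′ → y ≋ y′ → x ⊕ y ≋ x′ ⊕ y′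
    ⊕-cong {x} {x′} {y} {y′} x≋x′ y≋y′ = coeffwise λ g → begin
      ⟦ x ⊕ y ⟧ g          ≈⟨ coeff-⊕ x y g ⟩
      ⟦ x ⟧ g + ⟦ y ⟧ g    ≈⟨ +-cong (coeff-≈ x≋x′ g) (coeff-≈ y≋y′ g) ⟩
      ⟦ x′ ⟧ g + ⟦ y′ ⟧ g  ≈⟨ coeff-⊕ x′ y′ g ⟨
      ⟦ x′ ⊕ y′ ⟧ g        ∎

    ⊕-comm : ∀ x y → x ⊕ y ≋ y ⊕ x
    ⊕-comm x y = coeffwise λ g → trans (coeff-⊕ x y g) (trans (+-comm _ _) (sym (coeff-⊕ y x g)))

    ≋-reflexive : ∀ {x y} → x ≡ y → x ≋ y
    ≋-reflexive ≡.refl = ≋-refl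

    ⊕-assoc : ∀ x y z → (x ⊕ y) ⊕ z ≋ x ⊕ (y ⊕ z)
    ⊕-assoc x y z = ≋-reflexive (++-assoc x y z)

    ⊕-identityʳ : ∀ x → x ⊕ [] ≋ x
    ⊕-identityʳ x = coeffwise λ g → trans (coeff-⊕ x [] g) (+-identityʳ _)

    ⊕-neg-move : ∀ {x y w} → x ⊕ neg y ≋ w → x ≋ w ⊕ y
    ⊕-neg-move {x} {y} {w} x-y≋w = coeffwise λ g → begin
      ⟦ x ⟧ g
        ≈⟨ x-y+y≈x (⟦ x ⟧ g) (⟦ y ⟧ g) ⟨
      ⟦ x ⟧ g + - ⟦ y ⟧ g + ⟦ y ⟧ g
        ≈⟨ +-congʳ (trans (+-congˡ (sym (coeff-neg y g))) (sym (coeff-⊕ x (neg y) g))) ⟩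
      ⟦ x ⊕ neg y ⟧ g + ⟦ y ⟧ g
        ≈⟨ +-congʳ (coeff-≈ x-y≋w g) ⟩
      ⟦ w ⟧ g + ⟦ y ⟧ g
        ≈⟨ coeff-⊕ w y g ⟨
      ⟦ w ⊕ y ⟧ g ∎
      where
      x-y+y≈x : ∀ a b → a + - b + b ≈ a
      x-y+y≈x a b = trans (+-assoc a (- b) b) (trans (+-congˡ (-‿inverseˡ b)) (+-identityʳ a))

    ⊕-neg-cancelʳ : ∀ x y → (x ⊕ neg y) ⊕ y ≋ x
    ⊕-neg-cancelʳ x y = ≋-sym (⊕-neg-move ≋-refl)

    neg-⊕ : ∀ x y → neg (x ⊕ y) ≋ neg x ⊕ neg y
    neg-⊕ x y = ≋-reflexive (map-++ _ x y)

    ⊕-neg-interchange : ∀ a b d e → (a ⊕ neg b) ⊕ (d ⊕ neg e) ≋ (a ⊕ d) ⊕ neg (b ⊕ e)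
    ⊕-neg-interchange a b d e = coeffwise λ g → begin
      ⟦ (a ⊕ neg b) ⊕ (d ⊕ neg e) ⟧ g
        ≈⟨ trans (coeff-⊕ (a ⊕ neg b) (d ⊕ neg e) g) (+-cong (a-b a b g) (a-b d e g)) ⟩
      (⟦ a ⟧ g + - ⟦ b ⟧ g) + (⟦ d ⟧ g + - ⟦ e ⟧ g)
        ≈⟨ +-interchange _ _ _ _ ⟩
      (⟦ a ⟧ g + ⟦ d ⟧ g) + (- ⟦ b ⟧ g + - ⟦ e ⟧ g)
        ≈⟨ +-cong (sym (coeff-⊕ a d g)) (-‿+-comm _ _) ⟩
      ⟦ a ⊕ d ⟧ g + - (⟦ b ⟧ g + ⟦ e ⟧ g)
        ≈⟨ +-congˡ (-‿cong (sym (coeff-⊕ b e g))) ⟩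
      ⟦ a ⊕ d ⟧ g + - ⟦ b ⊕ e ⟧ g
        ≈⟨ a-b (a ⊕ d) (b ⊕ e) g ⟨
      ⟦ (a ⊕ d) ⊕ neg (b ⊕ e) ⟧ g ∎
      where
      a-b : ∀ x y g → ⟦ x ⊕ neg y ⟧ g ≈ ⟦ x ⟧ g + - ⟦ y ⟧ g
      a-b x y g = trans (coeff-⊕ x (neg y) g) (+-congˡ (coeff-neg y g))

    x⊕neg[x⊕neg-y]≋y : ∀ x y → x ⊕ neg (x ⊕ neg y) ≋ y
    x⊕neg[x⊕neg-y]≋y x y = coeffwise λ g → begin
      ⟦ x ⊕ neg (x ⊕ neg y) ⟧ g
        ≈⟨ trans (coeff-⊕ x _ g) (+-congˡ (coeff-neg (x ⊕ neg y) g)) ⟩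
      ⟦ x ⟧ g + - ⟦ x ⊕ neg y ⟧ g
        ≈⟨ +-congˡ (-‿cong (trans (coeff-⊕ x (neg y) g) (+-congˡ (coeff-neg y g)))) ⟩
      ⟦ x ⟧ g + - (⟦ x ⟧ g + - ⟦ y ⟧ g)
        ≈⟨ +-congˡ (-‿+-comm _ _) ⟨
      ⟦ x ⟧ g + (- ⟦ x ⟧ g + - - ⟦ y ⟧ g)
        ≈⟨ +-assoc _ _ _ ⟨
      (⟦ x ⟧ g + - ⟦ x ⟧ g) + - - ⟦ y ⟧ g
        ≈⟨ +-cong (-‿inverseʳ _) (-‿involutive _) ⟩
      0# + ⟦ y ⟧ g
        ≈⟨ +-identityˡ _ ⟩
      ⟦ y ⟧ g ∎

    neg-cong : ∀ {x y} → x ≋ y → neg x ≋ neg y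
    neg-cong {x} {y} x≋y = coeffwise λ g →
      trans (coeff-neg x g) (trans (-‿cong (coeff-≈ x≋y g)) (sym (coeff-neg y g)))

    cons-cong : ∀ {r r′ σ σ′ x y} → r ≈ r′ → σ ∼ σ′ → x ≋ y →
                (r , σ) ∷ x ≋ (r′ , σ′) ∷ y
    cons-cong {r} {r′} {σ} {σ′} {x} {y} r≈r′ σ∼σ′ x≋y = coeffwise coeffs
      where
      coeffs : ∀ g → ⟦ (r , σ) ∷ x ⟧ g ≈ ⟦ (r′ , σ′) ∷ y ⟧ g
      coeffs g with σ ∼? g
      ... | yes σ∼g = trans (+-cong r≈r′ (coeff-≈ x≋y g))
                            (sym (coeff-cons-∼ y (∼-trans (∼-sym σ∼σ′) σ∼g)))
      ... | no σ≁g  = trans (+-identityˡ _) (trans (coeff-≈ x≋y g) (sym (coeff-cons-≁ y σ′≁g)))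
        where
        σ′≁g : ¬ σ′ ∼ g
        σ′≁g σ′∼g = σ≁g (∼-trans σ∼σ′ σ′∼g)

    module _ {G : Set} where

      lin-cong : {F F′ : G → Chain Gen} → (∀ σ → F σ ≋ F′ σ) → ∀ x → lin F x ≋ lin F′ x
      lin-cong {F} {F′} F≋F′ x = coeffwise λ g → begin
        ⟦ lin F x ⟧ g                   ≈⟨ coeff-lin F x g ⟩
        pairing x (λ σ → ⟦ F σ ⟧ g)     ≈⟨ pairing-cong x (λ σ → coeff-≈ (F≋F′ σ) g) ⟩
        pairing x (λ σ → ⟦ F′ σ ⟧ g)    ≈⟨ coeff-lin F′ x g ⟨
        ⟦ lin F′ x ⟧ g                  ∎

      lin-⊕ : (F : G → Chain Gen) (x y : Chain G) → lin F (x ⊕ y) ≋ lin F x ⊕ lin F y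
      lin-⊕ F x y = coeffwise λ g → begin
        ⟦ lin F (x ⊕ y) ⟧ g
          ≈⟨ coeff-lin F (x ⊕ y) g ⟩
        pairing (x ⊕ y) (λ σ → ⟦ F σ ⟧ g)
          ≈⟨ pairing-⊕ x y _ ⟩
        pairing x (λ σ → ⟦ F σ ⟧ g) + pairing y (λ σ → ⟦ F σ ⟧ g)
          ≈⟨ +-cong (coeff-lin F x g) (coeff-lin F y g) ⟨
        ⟦ lin F x ⟧ g + ⟦ lin F y ⟧ g
          ≈⟨ coeff-⊕ (lin F x) (lin F y) g ⟨
        ⟦ lin F x ⊕ lin F y ⟧ g ∎

      lin-scale : (F : G → Chain Gen) (s : Carrier) (x : Chain G) → lin F (scale s x) ≋ scale s (lin F x)
      lin-scale F s x = coeffwise λ g → begin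
        ⟦ lin F (scale s x) ⟧ g                  ≈⟨ coeff-lin F (scale s x) g ⟩
        pairing (scale s x) (λ σ → ⟦ F σ ⟧ g)    ≈⟨ pairing-scale s x _ ⟩
        s * pairing x (λ σ → ⟦ F σ ⟧ g)          ≈⟨ *-congˡ (coeff-lin F x g) ⟨
        s * ⟦ lin F x ⟧ g                        ≈⟨ coeff-scale s (lin F x) g ⟨
        ⟦ scale s (lin F x) ⟧ g                  ∎

      lin-pointwise-⊕ : (F F′ : G → Chain Gen) (x : Chain G) →
                        lin (λ σ → F σ ⊕ F′ σ) x ≋ lin F x ⊕ lin F′ x
      lin-pointwise-⊕ F F′ x = coeffwise λ g → begin
        ⟦ lin (λ σ → F σ ⊕ F′ σ) x ⟧ g
          ≈⟨ coeff-lin _ x g ⟩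
        pairing x (λ σ → ⟦ F σ ⊕ F′ σ ⟧ g)
          ≈⟨ pairing-cong x (λ σ → coeff-⊕ (F σ) (F′ σ) g) ⟩
        pairing x (λ σ → ⟦ F σ ⟧ g + ⟦ F′ σ ⟧ g)
          ≈⟨ pairing-+ x _ _ ⟩
        pairing x (λ σ → ⟦ F σ ⟧ g) + pairing x (λ σ → ⟦ F′ σ ⟧ g)
          ≈⟨ +-cong (coeff-lin F x g) (coeff-lin F′ x g) ⟨
        ⟦ lin F x ⟧ g + ⟦ lin F′ x ⟧ g
          ≈⟨ coeff-⊕ (lin F x) (lin F′ x) g ⟨
        ⟦ lin F x ⊕ lin F′ x ⟧ g ∎

      lin-single : (F : G → Chain Gen) (σ : G) → lin F ((1# , σ) ∷ []) ≋ F σ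
      lin-single F σ = coeffwise λ g → trans (coeff-lin F ((1# , σ) ∷ []) g) (trans (+-identityʳ _) (*-identityˡ _))

      lin-lin : {H : Set} (F : H → Chain Gen) (F′ : G → Chain H) (x : Chain G) →
                lin F (lin F′ x) ≋ lin (λ σ → lin F (F′ σ)) x
      lin-lin F F′ x = coeffwise λ g → begin
        ⟦ lin F (lin F′ x) ⟧ g                           ≈⟨ coeff-lin F (lin F′ x) g ⟩
        pairing (lin F′ x) (λ τ → ⟦ F τ ⟧ g)             ≈⟨ pairing-lin F′ x _ ⟩
        pairing x (λ σ → pairing (F′ σ) (λ τ → ⟦ F τ ⟧ g)) ≈⟨ pairing-cong x (λ σ → coeff-lin F (F′ σ) g) ⟨
        pairing x (λ σ → ⟦ lin F (F′ σ) ⟧ g)            ≈⟨ coeff-lin _ x g ⟨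
        ⟦ lin (λ σ → lin F (F′ σ)) x ⟧ g                ∎

      lin-pointwise-neg : (F : G → Chain Gen) (x : Chain G) → lin (λ σ → neg (F σ)) x ≋ neg (lin F x)
      lin-pointwise-neg F x = coeffwise λ g → begin
        ⟦ lin (λ σ → neg (F σ)) x ⟧ g        ≈⟨ coeff-lin _ x g ⟩
        pairing x (λ σ → ⟦ neg (F σ) ⟧ g)    ≈⟨ pairing-cong x (λ σ → coeff-neg (F σ) g) ⟩
        pairing x (λ σ → - ⟦ F σ ⟧ g)        ≈⟨ pairing-neg x _ ⟩
        - pairing x (λ σ → ⟦ F σ ⟧ g)        ≈⟨ -‿cong (coeff-lin F x g) ⟨
        - ⟦ lin F x ⟧ g                      ≈⟨ coeff-neg (lin F x) g ⟨
        ⟦ neg (lin F x) ⟧ g                  ∎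

    lin-relabel : {G H : Set} (F : H → Chain Gen) (h : G → H) (x : Chain G) → lin F (relabel h x) ≋ lin (F ∘ h) x
    lin-relabel F h x = ≋-trans (lin-lin F (λ σ → (1# , h σ) ∷ []) x) (lin-cong (λ σ → lin-single F (h σ)) x)

    lin-unit : (x : Chain Gen) → relabel (λ σ → σ) x ≋ x
    lin-unit x = coeffwise λ g → begin
      ⟦ lin (λ σ → (1# , σ) ∷ []) x ⟧ g ≈⟨ coeff-lin (λ σ → (1# , σ) ∷ []) x g ⟩
      pairing x (λ σ → δ g σ + 0#)      ≈⟨ pairing-cong x (λ σ → +-identityʳ _) ⟩
      pairing x (δ g)                   ≈⟨ coeff≈pairing-δ x g ⟨
      ⟦ x ⟧ g                           ∎


    Respects : (Gen → Carrier) → Set ℓ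
    Respects φ = ∀ {σ τ} → σ ∼ τ → φ σ ≈ φ τ

    without : Gen → Chain Gen → Chain Gen
    without σ []            = []
    without σ ((r , τ) ∷ x) = if does (τ ∼? σ) then without σ x else (r , τ) ∷ without σ x

    length-without : ∀ σ (x : Chain Gen) → length (without σ x) ≤ length x
    length-without σ []            = z≤n
    length-without σ ((r , τ) ∷ x) with τ ∼? σ
    ... | yes _ = m≤n⇒m≤1+n (length-without σ x)
    ... | no _  = s≤s (length-without σ x)

    coeff-without-∼ : ∀ σ (x : Chain Gen) {g} → σ ∼ g → ⟦ without σ x ⟧ g ≈ 0#
    coeff-without-∼ σ []            σ∼g = refl
    coeff-without-∼ σ ((r , τ) ∷ x) σ∼g with τ ∼? σ
    ... | yes _   = coeff-without-∼ σ x σ∼g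
    ... | no τ≁σ  = trans (coeff-cons-≁ (without σ x) (λ τ∼g → τ≁σ (∼-trans τ∼g (∼-sym σ∼g))))
                          (coeff-without-∼ σ x σ∼g)

    coeff-without-≁ : ∀ σ (x : Chain Gen) {g} → ¬ σ ∼ g → ⟦ without σ x ⟧ g ≈ ⟦ x ⟧ g
    coeff-without-≁ σ []            σ≁g = refl
    coeff-without-≁ σ ((r , τ) ∷ x) σ≁g with τ ∼? σ
    ... | yes τ∼σ = trans (coeff-without-≁ σ x σ≁g)
                          (sym (coeff-cons-≁ x (λ τ∼g → σ≁g (∼-trans (∼-sym τ∼σ) τ∼g))))
    ... | no _    = +-congˡ (coeff-without-≁ σ x σ≁g)

    pairing-without : {φ : Gen → Carrier} → Respects φ →
                      ∀ σ (x : Chain Gen) → pairing x φ ≈ ⟦ x ⟧ σ * φ σ + pairing (without σ x) φ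
    pairing-without {φ} resp σ []            = sym (trans (+-identityʳ _) (zeroˡ (φ σ)))
    pairing-without {φ} resp σ ((r , τ) ∷ x) with τ ∼? σ
    ... | yes τ∼σ = begin
      r * φ τ + pairing x φ
        ≈⟨ +-cong (*-congˡ (resp τ∼σ)) (pairing-without resp σ x) ⟩
      r * φ σ + (⟦ x ⟧ σ * φ σ + pairing (without σ x) φ)
        ≈⟨ +-assoc _ _ _ ⟨
      (r * φ σ + ⟦ x ⟧ σ * φ σ) + pairing (without σ x) φ
        ≈⟨ +-congʳ (distribʳ (φ σ) r (⟦ x ⟧ σ)) ⟨
      (r + ⟦ x ⟧ σ) * φ σ + pairing (without σ x) φ ∎
    ... | no _ = begin
      r * φ τ + pairing x φ                                   ≈⟨ +-congˡ (pairing-without resp σ x) ⟩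
      r * φ τ + (⟦ x ⟧ σ * φ σ + pairing (without σ x) φ)    ≈⟨ x+[y+z]≈y+[x+z] _ _ _ ⟩
      ⟦ x ⟧ σ * φ σ + (r * φ τ + pairing (without σ x) φ)    ≈⟨ +-congʳ (*-congʳ (+-identityˡ _)) ⟨
      (0# + ⟦ x ⟧ σ) * φ σ + (r * φ τ + pairing (without σ x) φ) ∎

    -- Collect the terms at the head generator σ (their total coefficient ⟦ x ⟧ σ vanishes) and
    -- recurse on the strictly shorter remainder; n bounds the length.
    pairing-of-zero : {φ : Gen → Carrier} → Respects φ →
                      ∀ n (x : Chain Gen) → length x ≤ n → (∀ g → ⟦ x ⟧ g ≈ 0#) → pairing x φ ≈ 0#
    pairing-of-zero resp n       []                     _          x≈0 = refl
    pairing-of-zero {φ} resp (suc n) x@((r , σ) ∷ x′) (s≤s |x′|≤n) x≈0 = begin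
      pairing x φ                                ≈⟨ pairing-without resp σ x ⟩
      ⟦ x ⟧ σ * φ σ + pairing (without σ x) φ   ≈⟨ +-cong (*-congʳ (x≈0 σ)) rest≈0 ⟩
      0# * φ σ + 0#                             ≈⟨ trans (+-identityʳ _) (zeroˡ (φ σ)) ⟩
      0#                                        ∎
      where
      rest≈0 : pairing (without σ x) φ ≈ 0#
      rest≈0 with σ ∼? σ
      ... | no σ≁σ = ⊥-elim (σ≁σ ∼-refl)
      ... | yes _  = pairing-of-zero resp n (without σ x′) (≤-trans (length-without σ x′) |x′|≤n) vanishes
        where
        vanishes : ∀ g → ⟦ without σ x′ ⟧ g ≈ 0#
        vanishes g with σ ∼? g
        ... | yes σ∼g = coeff-without-∼ σ x′ σ∼g
        ... | no σ≁g  = trans (coeff-without-≁ σ x′ σ≁g) (trans (sym (coeff-cons-≁ x′ σ≁g)) (x≈0 g))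

    pairing-resp : {φ : Gen → Carrier} → Respects φ → ∀ {x y} → x ≋ y → pairing x φ ≈ pairing y φ
    pairing-resp {φ} resp {x} {y} x≋y = x∙y⁻¹≈ε⇒x≈y _ _ (begin
      pairing x φ - pairing y φ               ≈⟨ +-congˡ (-1*x≈-x _) ⟨
      pairing x φ + - 1# * pairing y φ        ≈⟨ +-congˡ (pairing-scale (- 1#) y φ) ⟨
      pairing x φ + pairing (neg y) φ         ≈⟨ pairing-⊕ x (neg y) φ ⟨
      pairing (x ⊕ neg y) φ                   ≈⟨ pairing-of-zero resp _ (x ⊕ neg y) ≤-refl difference≈0 ⟩
      0#                                      ∎)
      where
      difference≈0 : ∀ g → ⟦ x ⊕ neg y ⟧ g ≈ 0#
      difference≈0 g = trans (coeff-⊕ x (neg y) g)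
                         (trans (+-cong (coeff-≈ x≋y g) (coeff-neg y g)) (-‿inverseʳ _))

  module _ {G : Set} {P : G → Set} where

    InSpan-map : {Q : G → Set} → (∀ σ → P σ → Q σ) → ∀ {x} → InSpan P x → InSpan Q x
    InSpan-map P⇒Q = All.map (λ {p} → P⇒Q (proj₂ p))

    InSpan-⊕ : ∀ {x y} → InSpan P x → InSpan P y → InSpan P (x ⊕ y)
    InSpan-⊕ = ++⁺

    InSpan-scale : ∀ s {x} → InSpan P x → InSpan P (scale s x)
    InSpan-scale s = map⁺

    InSpan-lin : {H : Set} {Q : H → Set} (F : H → Chain G) → (∀ σ → Q σ → InSpan P (F σ)) →
                 ∀ {x} → InSpan Q x → InSpan P (lin F x)
    InSpan-lin F F∈span []       = []
    InSpan-lin F F∈span (q ∷ qs) = InSpan-⊕ (InSpan-scale _ (F∈span _ q)) (InSpan-lin F F∈span qs)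

    InSpan-lin-total : {H : Set} (F : H → Chain G) → (∀ σ → InSpan P (F σ)) → ∀ x → InSpan P (lin F x)
    InSpan-lin-total F F∈span []            = []
    InSpan-lin-total F F∈span ((r , σ) ∷ x) = InSpan-⊕ (InSpan-scale r (F∈span σ)) (InSpan-lin-total F F∈span x)

  module _ {S T : DecSetoid 0ℓ 0ℓ} where
    private
      module S = Coefficients S
      module T = Coefficients T
    open SetoidReasoning setoid

    lin-resp : (F : S.Gen → Chain T.Gen) → (∀ {σ τ} → σ S.∼ τ → F σ T.≋ F τ) →
               ∀ {x y} → x S.≋ y → lin F x T.≋ lin F y
    lin-resp F F-resp {x} {y} x≋y = T.coeffwise λ g → begin
      T.⟦ lin F x ⟧ g                   ≈⟨ T.coeff-lin F x g ⟩
      pairing x (λ σ → T.⟦ F σ ⟧ g)     ≈⟨ S.pairing-resp (λ σ∼τ → T.coeff-≈ (F-resp σ∼τ) g) x≋y ⟩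
      pairing y (λ σ → T.⟦ F σ ⟧ g)     ≈⟨ T.coeff-lin F y g ⟨
      T.⟦ lin F y ⟧ g                   ∎

  module Modulo (S : DecSetoid 0ℓ 0ℓ) (P : DecSetoid.Carrier S → Set) where
    open Coefficients S

    -- Equality in the quotient of the free module by the span of P: the paper's C_n = L_n / D_n
    -- (P = degenerate cubes) and C_n(V) (P = non-regular tuples).
    infix 4 _≈ₘ_
    record _≈ₘ_ (x y : Chain Gen) : Set (c ⊔ ℓ) where
      constructor modulo
      field
        defect      : Chain Gen
        defect∈span : InSpan P defect
        ≋⊕defect    : x ≋ y ⊕ defect
    open _≈ₘ_ public

    ≋⇒≈ₘ : ∀ {x y} → x ≋ y → x ≈ₘ y
    ≋⇒≈ₘ {x} {y} x≋y = modulo [] [] (coeffwise λ g →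
      trans (coeff-≈ x≋y g) (trans (sym (+-identityʳ _)) (sym (coeff-⊕ y [] g))))

    span≈ₘ[] : ∀ {d} → InSpan P d → d ≈ₘ []
    span≈ₘ[] d∈span = modulo _ d∈span ≋-refl

    ≈ₘ-refl : ∀ {x} → x ≈ₘ x
    ≈ₘ-refl = ≋⇒≈ₘ ≋-refl

    ≈ₘ-sym : ∀ {x y} → x ≈ₘ y → y ≈ₘ x
    ≈ₘ-sym {x} {y} (modulo d d∈span x≋y⊕d) = modulo (neg d) (InSpan-scale (- 1#) d∈span) (coeffwise λ g → begin
      ⟦ y ⟧ g
        ≈⟨ x+y-y≈x (⟦ y ⟧ g) (⟦ d ⟧ g) ⟨
      ⟦ y ⟧ g + ⟦ d ⟧ g + - ⟦ d ⟧ g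
        ≈⟨ +-cong (trans (sym (coeff-⊕ y d g)) (sym (coeff-≈ x≋y⊕d g))) (sym (coeff-neg d g)) ⟩
      ⟦ x ⟧ g + ⟦ neg d ⟧ g
        ≈⟨ coeff-⊕ x (neg d) g ⟨
      ⟦ x ⊕ neg d ⟧ g ∎)
      where
      open SetoidReasoning setoid
      x+y-y≈x : ∀ a b → a + b + - b ≈ a
      x+y-y≈x a b = trans (+-assoc a b (- b)) (trans (+-congˡ (-‿inverseʳ b)) (+-identityʳ a))

    ≈ₘ-trans : ∀ {x y z} → x ≈ₘ y → y ≈ₘ z → x ≈ₘ z
    ≈ₘ-trans {x} {y} {z} (modulo d d∈span x≋y⊕d) (modulo e e∈span y≋z⊕e) =
      modulo (e ⊕ d) (InSpan-⊕ e∈span d∈span) (coeffwise λ g → begin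
        ⟦ x ⟧ g                        ≈⟨ trans (coeff-≈ x≋y⊕d g) (coeff-⊕ y d g) ⟩
        ⟦ y ⟧ g + ⟦ d ⟧ g              ≈⟨ +-congʳ (trans (coeff-≈ y≋z⊕e g) (coeff-⊕ z e g)) ⟩
        ⟦ z ⟧ g + ⟦ e ⟧ g + ⟦ d ⟧ g    ≈⟨ +-assoc _ _ _ ⟩
        ⟦ z ⟧ g + (⟦ e ⟧ g + ⟦ d ⟧ g)  ≈⟨ trans (+-congˡ (sym (coeff-⊕ e d g))) (sym (coeff-⊕ z (e ⊕ d) g)) ⟩
        ⟦ z ⊕ (e ⊕ d) ⟧ g              ∎)
      where open SetoidReasoning setoid

    ≈ₘ-setoid : Setoid c (c ⊔ ℓ)
    ≈ₘ-setoid = record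
      { Carrier       = Chain Gen
      ; _≈_           = _≈ₘ_
      ; isEquivalence = record { refl = ≈ₘ-refl ; sym = ≈ₘ-sym ; trans = ≈ₘ-trans }
      }

    module ≈ₘ-Reasoning = SetoidReasoning ≈ₘ-setoid

    ⊕-congₘ : ∀ {x x′ y y′} → x ≈ₘ x′ → y ≈ₘ y′ → x ⊕ y ≈ₘ x′ ⊕ y′
    ⊕-congₘ {x} {x′} {y} {y′} (modulo d d∈span x≋x′⊕d) (modulo e e∈span y≋y′⊕e) =
      modulo (d ⊕ e) (InSpan-⊕ d∈span e∈span) (coeffwise λ g → begin
        ⟦ x ⊕ y ⟧ g                                   ≈⟨ coeff-⊕ x y g ⟩
        ⟦ x ⟧ g + ⟦ y ⟧ g                             ≈⟨ +-cong (trans (coeff-≈ x≋x′⊕d g) (coeff-⊕ x′ d g))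
                                                                (trans (coeff-≈ y≋y′⊕e g) (coeff-⊕ y′ e g)) ⟩
        (⟦ x′ ⟧ g + ⟦ d ⟧ g) + (⟦ y′ ⟧ g + ⟦ e ⟧ g)   ≈⟨ +-interchange _ _ _ _ ⟩
        (⟦ x′ ⟧ g + ⟦ y′ ⟧ g) + (⟦ d ⟧ g + ⟦ e ⟧ g)   ≈⟨ +-cong (coeff-⊕ x′ y′ g) (coeff-⊕ d e g) ⟨
        ⟦ x′ ⊕ y′ ⟧ g + ⟦ d ⊕ e ⟧ g                   ≈⟨ coeff-⊕ (x′ ⊕ y′) (d ⊕ e) g ⟨
        ⟦ (x′ ⊕ y′) ⊕ (d ⊕ e) ⟧ g                     ∎)
      where open SetoidReasoning setoid

    InSpan-⊎⇒≈ₘ : {A : Gen → Set} → ∀ {x} → InSpan (λ σ → A σ ⊎ P σ) x →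
                  ∃[ a ] (InSpan A a × x ≈ₘ a)
    InSpan-⊎⇒≈ₘ []                          = [] , [] , ≈ₘ-refl
    InSpan-⊎⇒≈ₘ {x = (r , σ) ∷ x} (inj₁ Aσ ∷ x∈span) with InSpan-⊎⇒≈ₘ x∈span
    ... | a , a∈span , x≈a = (r , σ) ∷ a , Aσ ∷ a∈span , ⊕-congₘ (≈ₘ-refl {x = (r , σ) ∷ []}) x≈a
    InSpan-⊎⇒≈ₘ {x = (r , σ) ∷ x} (inj₂ Pσ ∷ x∈span) with InSpan-⊎⇒≈ₘ x∈span
    ... | a , a∈span , x≈a = a , a∈span , ⊕-congₘ (span≈ₘ[] (Pσ ∷ [])) x≈a

    ≈ₘ-∂-trans : {B : Set} (∂ : B → Chain Gen) {x y z : Chain Gen} (u w : Chain B) →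
                 x ≈ₘ lin ∂ u ⊕ y → y ≈ₘ lin ∂ w ⊕ z → x ≈ₘ lin ∂ (u ⊕ w) ⊕ z
    ≈ₘ-∂-trans ∂ {x} {y} {z} u w x≈∂u+y y≈∂w+z = begin
      x                            ≈⟨ x≈∂u+y ⟩
      lin ∂ u ⊕ y                  ≈⟨ ⊕-congₘ (≈ₘ-refl {x = lin ∂ u}) y≈∂w+z ⟩
      lin ∂ u ⊕ (lin ∂ w ⊕ z)      ≈⟨ ≋⇒≈ₘ (≋-sym (⊕-assoc (lin ∂ u) (lin ∂ w) z)) ⟩
      (lin ∂ u ⊕ lin ∂ w) ⊕ z      ≈⟨ ≋⇒≈ₘ (⊕-cong (≋-sym (lin-⊕ ∂ u w)) (≋-refl {x = z})) ⟩
      lin ∂ (u ⊕ w) ⊕ z            ∎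
      where open ≈ₘ-Reasoning


  module _ {S T : DecSetoid 0ℓ 0ℓ} {P : DecSetoid.Carrier S → Set} {Q : DecSetoid.Carrier T → Set} where
    private
      module S = Coefficients S
      module T = Coefficients T
      module Sₘ = Modulo S P
      module Tₘ = Modulo T Q

    lin-respₘ : (F : S.Gen → Chain T.Gen) → (∀ {σ τ} → σ S.∼ τ → F σ T.≋ F τ) →
                (∀ σ → P σ → InSpan Q (F σ)) → ∀ {x y} → x Sₘ.≈ₘ y → lin F x Tₘ.≈ₘ lin F y
    lin-respₘ F F-resp F-span {x} {y} (Sₘ.modulo d d∈span x≋y⊕d) =
      Tₘ.modulo (lin F d) (InSpan-lin F F-span d∈span) (T.≋-trans (lin-resp F F-resp x≋y⊕d) (T.lin-⊕ F y d))

  lin-chainHomotopy : (S : DecSetoid 0ℓ 0ℓ) → let open Coefficients S in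
                      {A A′ B : Set} (∂A : A → Chain A′) (∂B : B → Chain Gen)
                      (h : A → Chain B) (h′ : A′ → Chain Gen) (F F′ : A → Chain Gen) →
                      (∀ κ → lin ∂B (h κ) ⊕ lin h′ (∂A κ) ≋ F κ ⊕ neg (F′ κ)) →
                      ∀ z → lin ∂B (lin h z) ⊕ lin h′ (lin ∂A z) ≋ lin F z ⊕ neg (lin F′ z)
  lin-chainHomotopy S ∂A ∂B h h′ F F′ homotopy z = begin
    lin ∂B (lin h z) ⊕ lin h′ (lin ∂A z)                     ≈⟨ ⊕-cong (lin-lin ∂B h z) (lin-lin h′ ∂A z) ⟩
    lin (λ κ → lin ∂B (h κ)) z ⊕ lin (λ κ → lin h′ (∂A κ)) z ≈⟨ lin-pointwise-⊕ _ _ z ⟨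
    lin (λ κ → lin ∂B (h κ) ⊕ lin h′ (∂A κ)) z              ≈⟨ lin-cong homotopy z ⟩
    lin (λ κ → F κ ⊕ neg (F′ κ)) z                          ≈⟨ lin-pointwise-⊕ _ _ z ⟩
    lin F z ⊕ lin (λ κ → neg (F′ κ)) z                      ≈⟨ ⊕-cong ≋-refl (lin-pointwise-neg F′ z) ⟩
    lin F z ⊕ neg (lin F′ z)                                ∎
    where
    open Coefficients S
    open ≋-Reasoning

  module _ {A′ A B : DecSetoid 0ℓ 0ℓ}
           {D′ : DecSetoid.Carrier A′ → Set} {D : DecSetoid.Carrier A → Set} where
    private
      module A′ = Coefficients A′
      module A = Coefficients A
      module B = Coefficients B
      module A′ₘ = Modulo A′ D′
      module Aₘ = Modulo A D

    chainHomotopy-onCycles :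
      (∂A : A.Gen → Chain A′.Gen) (∂B : B.Gen → Chain A.Gen)
      (h : A.Gen → Chain B.Gen) (h′ : A′.Gen → Chain A.Gen) (F G : A.Gen → Chain A.Gen) →
      (∀ κ → lin ∂B (h κ) ⊕ lin h′ (∂A κ) A.≋ F κ ⊕ neg (G κ)) →
      (∀ {σ τ} → σ A′.∼ τ → h′ σ A.≋ h′ τ) → (∀ σ → D′ σ → InSpan D (h′ σ)) →
      ∀ z → lin ∂A z A′ₘ.≈ₘ [] → lin F z Aₘ.≈ₘ lin ∂B (lin h z) ⊕ lin G z
    chainHomotopy-onCycles ∂A ∂B h h′ F G homotopy h′-resp h′-span z z-cycle = begin
      lin F z
        ≈⟨ Aₘ.≋⇒≈ₘ (A.⊕-neg-move onChains) ⟩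
      (lin ∂B (lin h z) ⊕ lin h′ (lin ∂A z)) ⊕ lin G z
        ≈⟨ Aₘ.⊕-congₘ (Aₘ.⊕-congₘ (Aₘ.≈ₘ-refl {lin ∂B (lin h z)}) h′∂z≈ₘ[])
           (Aₘ.≈ₘ-refl {lin G z}) ⟩
      (lin ∂B (lin h z) ⊕ []) ⊕ lin G z
        ≈⟨ Aₘ.≋⇒≈ₘ (A.⊕-cong (A.⊕-identityʳ _) (A.≋-refl {lin G z})) ⟩
      lin ∂B (lin h z) ⊕ lin G z ∎
      where
      open Aₘ.≈ₘ-Reasoning
      h′∂z≈ₘ[] : lin h′ (lin ∂A z) Aₘ.≈ₘ []
      h′∂z≈ₘ[] = lin-respₘ h′ h′-resp h′-span z-cycle
      onChains : lin F z ⊕ neg (lin G z) A.≋ lin ∂B (lin h z) ⊕ lin h′ (lin ∂A z)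
      onChains = A.≋-sym (lin-chainHomotopy A ∂A ∂B h h′ F G homotopy z)

module Endomorphisms (G : Graph) where
  open Graph G

  EqOrAdj : V → V → Set
  EqOrAdj u v = u ≡ v ⊎ E u v

  record Endo : Set where
    constructor endo
    field
      map     : V → V
      map-hom : ∀ {u v} → EqOrAdj u v → EqOrAdj (map u) (map v)
  open Endo public

  idᴱ : Endo
  idᴱ = endo (λ v → v) (λ u≃v → u≃v)

  constᴱ : V → Endo
  constᴱ v₀ = endo (λ _ → v₀) (λ _ → inj₁ ≡.refl)

  EqOrAdj-sym : Symmetric E → Symmetric EqOrAdj
  EqOrAdj-sym E-sym (inj₁ u≡v) = inj₁ (≡.sym u≡v)
  EqOrAdj-sym E-sym (inj₂ uv)  = inj₂ (E-sym uv)

  OneStepHomotopy : Endo → Endo → Set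
  OneStepHomotopy f g = ∀ v → EqOrAdj (map f v) (map g v)

  -- The paper's A-homotopy: a map G □ Iₙ → G is a chain of n one-step homotopies.
  data Homotopic : Endo → Endo → Set where
    homotopic-refl : ∀ {f} → Homotopic f f
    homotopic-step : ∀ {f g h} → OneStepHomotopy f g → Homotopic g h → Homotopic f h

  Contractible : Set
  Contractible = ∃[ v₀ ] Homotopic idᴱ (constᴱ v₀)

module CubicalHomotopy {c ℓ : Level} (R : CommutativeRing c ℓ) (G : Graph)
                       (E-sym : Symmetric (Graph.E G)) where
  open CommutativeRing R hiding (zero)
  open FreeModule R
  open LinearCombinations R
  open Graph G
  open Endomorphisms G
  open Cubical R G
  open import Algebra.Properties.Ring ring using (-1*x≈-x; -‿involutive)

  cubes : ℕ → DecSetoid 0ℓ 0ℓ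
  cubes n = record
    { Carrier          = Cube n
    ; _≈_              = _∼_
    ; isDecEquivalence = record
      { isEquivalence = record
        { refl  = λ _ → ≡.refl
        ; sym   = λ κ∼τ a → ≡.sym (κ∼τ a)
        ; trans = λ κ∼τ τ∼υ a → ≡.trans (κ∼τ a) (τ∼υ a)
        }
      ; _≟_ = _∼?_
      }
    }

  module C {n : ℕ} = Coefficients (cubes n)
  module Cₘ {n : ℕ} = Modulo (cubes n) Degenerate

  _∘ᶜ_ : ∀ {n} → Endo → Cube n → Cube n
  f ∘ᶜ κ = cube (map f ∘ σ κ) (map-hom f ∘ hom κ)

  pushᵍ : ∀ {n} → Endo → Cube n → CChain n
  pushᵍ f κ = (1# , f ∘ᶜ κ) ∷ []

  push : ∀ {n} → Endo → CChain n → CChain n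
  push f = relabel (f ∘ᶜ_)

  -- The summand of ∂gen at face i: ∂gen κ is definitionally concat (map (faceTerms κ) (allFin _)).
  faceTerms : ∀ {n} → Cube (suc n) → Fin (suc n) → CChain n
  faceTerms κ i = (sgn (suc (toℕ i)) , face i false κ) ∷ (- sgn (suc (toℕ i)) , face i true κ) ∷ []

  module Prism {f g : Endo} (H : OneStepHomotopy f g) where

    prism-σ : ∀ {n} → Cube n → Vec Bool (suc n) → V
    prism-σ κ (true  ∷ a) = map f (σ κ a)
    prism-σ κ (false ∷ a) = map g (σ κ a)

    prism-hom : ∀ {n} (κ : Cube n) {a b} → QAdj a b → EqOrAdj (prism-σ κ a) (prism-σ κ b)
    prism-hom κ (here {x = true}  {true}  x≢y) = ⊥-elim (x≢y ≡.refl)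
    prism-hom κ (here {x = true}  {false} _)   = H _
    prism-hom κ (here {x = false} {true}  _)   = EqOrAdj-sym E-sym (H _)
    prism-hom κ (here {x = false} {false} x≢y) = ⊥-elim (x≢y ≡.refl)
    prism-hom κ (there {x = true}  a~b)        = map-hom f (hom κ a~b)
    prism-hom κ (there {x = false} a~b)        = map-hom g (hom κ a~b)

    prism : ∀ {n} → Cube n → Cube (suc n)
    prism κ = cube (prism-σ κ) (prism-hom κ)

    prismᶜ : ∀ {n} → Cube n → CChain (suc n)
    prismᶜ κ = (1# , prism κ) ∷ []

    prism-resp : ∀ {n} {κ τ : Cube n} → κ ∼ τ → prismᶜ κ C.≋ prismᶜ τ
    prism-resp κ∼τ = C.cons-cong refl pointwise C.≋-refl
      where
      pointwise : ∀ a → prism-σ _ a ≡ prism-σ _ a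
      pointwise (true  ∷ a) = ≡.cong (map f) (κ∼τ a)
      pointwise (false ∷ a) = ≡.cong (map g) (κ∼τ a)

    face-prism : ∀ {n} (κ : Cube (suc n)) i e → face (suc i) e (prism κ) ∼ prism (face i e κ)
    face-prism κ i e (true  ∷ a) = ≡.refl
    face-prism κ i e (false ∷ a) = ≡.refl

    prism-degenerate : ∀ {n} (κ : Cube n) → Degenerate κ → Degenerate (prism κ)
    prism-degenerate {suc n} κ (i , faces≈) = suc i , pointwise
      where
      pointwise : ∀ a → σ (face (suc i) true (prism κ)) a ≡ σ (face (suc i) false (prism κ)) a
      pointwise (true  ∷ a) = ≡.cong (map f) (faces≈ a)
      pointwise (false ∷ a) = ≡.cong (map g) (faces≈ a)

    faceTerms-prism : ∀ {n} (κ : Cube (suc n)) i → faceTerms (prism κ) (suc i) C.≋ neg (lin prismᶜ (faceTerms κ i))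
    faceTerms-prism κ i =
      C.cons-cong (-≈-1*[x*1] _) (face-prism κ i false)
        (C.cons-cong (-≈-1*[x*1] _) (face-prism κ i true) C.≋-refl)
      where
      -≈-1*[x*1] : ∀ s → - s ≈ - 1# * (s * 1#)
      -≈-1*[x*1] s = trans (-‿cong (sym (*-identityʳ s))) (sym (-1*x≈-x _))

    ∂gen-prism : ∀ {m} (κ : Cube (suc m)) →
                 ∂gen (prism κ) C.≋ (pushᵍ f κ ⊕ neg (pushᵍ g κ)) ⊕ neg (lin prismᶜ (∂gen κ))
    ∂gen-prism {m} κ = C.⊕-cong {x = faceTerms (prism κ) zero} firstFace otherFaces
      where
      firstFace : faceTerms (prism κ) zero C.≋ pushᵍ f κ ⊕ neg (pushᵍ g κ)
      firstFace = C.≋-trans (C.⊕-comm ((- 1# , _) ∷ []) ((- - 1# , _) ∷ []))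
                    (C.cons-cong (-‿involutive 1#) (λ _ → ≡.refl)
                      (C.cons-cong (sym (*-identityʳ _)) (λ _ → ≡.refl) C.≋-refl))
      faceTerms-prisms : (L : List (Fin (suc m))) →
                         concat (List.map (faceTerms (prism κ) ∘ suc) L) C.≋
                         neg (lin prismᶜ (concat (List.map (faceTerms κ) L)))
      faceTerms-prisms []      = C.≋-refl
      faceTerms-prisms (i ∷ L) = C.≋-trans (C.⊕-cong (faceTerms-prism κ i) (faceTerms-prisms L))
        (C.≋-sym (C.≋-trans (C.neg-cong (C.lin-⊕ prismᶜ (faceTerms κ i) rest))
                            (C.neg-⊕ (lin prismᶜ (faceTerms κ i)) (lin prismᶜ rest))))
        where rest = concat (List.map (faceTerms κ) L)
      otherFaces : concat (List.map (faceTerms (prism κ)) (tabulate suc)) C.≋ neg (lin prismᶜ (∂gen κ))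
      otherFaces = C.≋-trans
        (C.≋-reflexive (≡.cong concat (≡.trans (map-tabulate suc (faceTerms (prism κ)))
                                               (≡.sym (map-tabulate (λ i → i) (faceTerms (prism κ) ∘ suc))))))
        (faceTerms-prisms (allFin (suc m)))

    prism-homotopy : ∀ {m} (κ : Cube (suc m)) →
      lin ∂gen (prismᶜ κ) ⊕ lin prismᶜ (∂gen κ) C.≋ pushᵍ f κ ⊕ neg (pushᵍ g κ)
    prism-homotopy κ = C.≋-trans (C.⊕-cong (C.≋-trans (C.lin-single ∂gen (prism κ)) (∂gen-prism κ)) C.≋-refl)
                                 (C.⊕-neg-cancelʳ _ (lin prismᶜ (∂gen κ)))

    push-homotopy : ∀ {m} (z : CChain (suc m)) → ∂ z Cₘ.≈ₘ [] →
                    push f z Cₘ.≈ₘ ∂ (lin prismᶜ z) ⊕ push g z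
    push-homotopy {m} z = chainHomotopy-onCycles
      {cubes m} {cubes (suc m)} {cubes (suc (suc m))} {Degenerate} {Degenerate}
      ∂gen ∂gen prismᶜ prismᶜ (pushᵍ f) (pushᵍ g) prism-homotopy prism-resp
      (λ κ κ-degenerate → prism-degenerate κ κ-degenerate ∷ []) z

  push-homotopic : ∀ {f g} → Homotopic f g → ∀ {m} (z : CChain (suc m)) → ∂ z Cₘ.≈ₘ [] →
                   ∃[ w ] (push f z Cₘ.≈ₘ ∂ w ⊕ push g z)
  push-homotopic homotopic-refl z z-cycle = [] , Cₘ.≈ₘ-refl
  push-homotopic {f} (homotopic-step {g = g} f≃₁g g≃h) z z-cycle with push-homotopic g≃h z z-cycle
  ... | w , gz≈∂w+hz =
    lin prismᶜ z ⊕ w , Cₘ.≈ₘ-∂-trans ∂gen (lin prismᶜ z) w (push-homotopy z z-cycle) gz≈∂w+hz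
    where open Prism {f} {g} f≃₁g

  constant-degenerate : ∀ {m} v₀ (κ : Cube (suc m)) → Degenerate (constᴱ v₀ ∘ᶜ κ)
  constant-degenerate v₀ κ = zero , λ _ → ≡.refl

  contractible⇒cubeHomologyVanishes : Contractible → ∀ m → CubeHomologyVanishes (suc m)
  contractible⇒cubeHomologyVanishes (v₀ , id≃const) m z (d , d∈span , ∂z≈d) =
    w , Cₘ.defect z≈∂w , Cₘ.defect∈span z≈∂w , C.coeff-≈ (Cₘ.≋⊕defect z≈∂w)
    where
    z-cycle : ∂ z Cₘ.≈ₘ []
    z-cycle = Cₘ.modulo d d∈span (C.coeffwise ∂z≈d)
    w : CChain (suc (suc m))
    w = proj₁ (push-homotopic id≃const z z-cycle)
    constant≈ₘ[] : push (constᴱ v₀) z Cₘ.≈ₘ []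
    constant≈ₘ[] = Cₘ.span≈ₘ[]
      (InSpan-lin-total (pushᵍ (constᴱ v₀)) (λ κ → constant-degenerate v₀ κ ∷ []) z)
    z≈∂w : z Cₘ.≈ₘ ∂ w
    z≈∂w = begin
      z                             ≈⟨ Cₘ.≋⇒≈ₘ (C.≋-sym (C.lin-unit z)) ⟩
      push idᴱ z                    ≈⟨ proj₂ (push-homotopic id≃const z z-cycle) ⟩
      ∂ w ⊕ push (constᴱ v₀) z      ≈⟨ Cₘ.⊕-congₘ (Cₘ.≈ₘ-refl {x = ∂ w}) constant≈ₘ[] ⟩
      ∂ w ⊕ []                      ≈⟨ Cₘ.≋⇒≈ₘ (C.⊕-identityʳ (∂ w)) ⟩
      ∂ w                           ∎
      where open Cₘ.≈ₘ-Reasoning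

module PathHomotopy {c ℓ : Level} (R : CommutativeRing c ℓ) (G : Graph)
                    (E-sym : Symmetric (Graph.E G)) where
  open CommutativeRing R hiding (zero)
  open FreeModule R
  open LinearCombinations R
  open Graph G
  open Endomorphisms G
  open PathH R G
  open import Algebra.Properties.Ring ring using (-1*x≈-x)

  tuples : ℕ → DecSetoid 0ℓ 0ℓ
  tuples k = ≡.decSetoid (VecP.≡-dec {n = k} _≟_)

  module T {k : ℕ} = Coefficients (tuples k)
  module Tₘ {k : ℕ} = Modulo (tuples k) NonRegular

  -- ∂gen is ∂ᵛ restricted to tuples of length ≥ 2; the induction in prism-homotopy also needs 1-tuples.
  ∂ᵛ : ∀ {k} → Vec V (suc k) → Chain (Vec V k)
  ∂ᵛ {k} v = List.map (λ i → (sgn (toℕ i) , removeAt v i)) (allFin (suc k))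

  infixr 25 _◃_
  _◃_ : ∀ {k} → V → Chain (Vec V k) → Chain (Vec V (suc k))
  a ◃ c = relabel (a ∷_) c

  removeAt-map : ∀ {k} (h : V → V) (v : Vec V (suc k)) i → removeAt (Vec.map h v) i ≡ Vec.map h (removeAt v i)
  removeAt-map h (x ∷ xs)     zero    = ≡.refl
  removeAt-map h (x ∷ y ∷ xs) (suc i) = ≡.cong (h x ∷_) (removeAt-map h (y ∷ xs) i)

  ∂ᵛ-map : ∀ {k} (h : V → V) (v : Vec V (suc k)) → ∂ᵛ (Vec.map h v) T.≋ relabel (Vec.map h) (∂ᵛ v)
  ∂ᵛ-map {k} h v = go (allFin (suc k))
    where
    go : (L : List (Fin (suc k))) →
         List.map (λ i → (sgn (toℕ i) , removeAt (Vec.map h v) i)) L T.≋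
         relabel (Vec.map h) (List.map (λ i → (sgn (toℕ i) , removeAt v i)) L)
    go []      = T.≋-refl
    go (i ∷ L) = T.cons-cong (sym (*-identityʳ _)) (removeAt-map h v i) (go L)

  ∂ᵛ-cons : ∀ {k} (a : V) (u : Vec V (suc k)) → ∂ᵛ (a ∷ u) T.≋ ((1# , u) ∷ []) ⊕ neg (a ◃ ∂ᵛ u)
  ∂ᵛ-cons {k} a u@(_ ∷ _) = T.cons-cong refl ≡.refl (T.≋-trans (T.≋-reflexive reindex) (go (allFin (suc k))))
    where
    φ : Fin (suc (suc k)) → Carrier × Vec V (suc k)
    φ i = (sgn (toℕ i) , removeAt (a ∷ u) i)
    reindex : List.map φ (tabulate suc) ≡ List.map (φ ∘ suc) (allFin (suc k))
    reindex = ≡.trans (map-tabulate suc φ) (≡.sym (map-tabulate (λ i → i) (φ ∘ suc)))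
    go : (L : List (Fin (suc k))) →
         List.map (φ ∘ suc) L T.≋ neg (a ◃ List.map (λ i → (sgn (toℕ i) , removeAt u i)) L)
    go []      = T.≋-refl
    go (i ∷ L) = T.cons-cong (trans (sym (-1*x≈-x _)) (*-congˡ (sym (*-identityʳ _)))) ≡.refl (go L)

  ∂-cone : ∀ {k} (a : V) (c : Chain (Vec V (suc k))) → lin ∂ᵛ (a ◃ c) T.≋ c ⊕ neg (a ◃ lin ∂ᵛ c)
  ∂-cone {k} a c = begin
    lin ∂ᵛ (a ◃ c)
      ≈⟨ T.lin-relabel ∂ᵛ (a ∷_) c ⟩
    lin (λ u → ∂ᵛ (a ∷ u)) c
      ≈⟨ T.lin-cong (∂ᵛ-cons a) c ⟩
    lin (λ u → ((1# , u) ∷ []) ⊕ neg (a ◃ ∂ᵛ u)) c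
      ≈⟨ T.lin-pointwise-⊕ (λ u → (1# , u) ∷ []) (λ u → neg (a ◃ ∂ᵛ u)) c ⟩
    relabel (λ u → u) c ⊕ lin (λ u → neg (a ◃ ∂ᵛ u)) c
      ≈⟨ T.⊕-cong (T.lin-unit c) (T.lin-pointwise-neg (λ u → a ◃ ∂ᵛ u) c) ⟩
    c ⊕ neg (lin (λ u → a ◃ ∂ᵛ u) c)
      ≈⟨ T.⊕-cong (T.≋-refl {x = c}) (T.neg-cong (T.lin-lin (λ u → (1# , a ∷ u) ∷ []) ∂ᵛ c)) ⟨
    c ⊕ neg (a ◃ lin ∂ᵛ c) ∎
    where open T.≋-Reasoning {suc k}

  relabel-cong : ∀ {k j} (h : Vec V k → Vec V j) {c c′ : Chain (Vec V k)} →
                 c T.≋ c′ → relabel h c T.≋ relabel h c′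
  relabel-cong h = lin-resp (λ u → (1# , h u) ∷ []) (λ { ≡.refl → T.≋-refl })

  ◃-cong : ∀ {k} (a : V) {c c′ : Chain (Vec V k)} → c T.≋ c′ → a ◃ c T.≋ a ◃ c′
  ◃-cong a = relabel-cong (a ∷_)

  pushᵍ : ∀ {k} → Endo → Vec V k → Chain (Vec V k)
  pushᵍ f v = (1# , Vec.map (map f) v) ∷ []

  push : ∀ {k} → Endo → Chain (Vec V k) → Chain (Vec V k)
  push f = relabel (Vec.map (map f))

  push-id : ∀ {k} (x : Chain (Vec V k)) → push idᴱ x T.≋ x
  push-id x = T.≋-trans (T.lin-cong (λ v → T.cons-cong refl (VecP.map-id v) T.≋-refl) x) (T.lin-unit x)

  ∂-pushᵍ : ∀ {k} (f : Endo) (x : V) (u : Vec V (suc k)) →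
            lin ∂ᵛ (pushᵍ f (x ∷ u)) T.≋ pushᵍ f u ⊕ neg (push f (x ◃ ∂ᵛ u))
  ∂-pushᵍ {k} f x u = begin
    lin ∂ᵛ (pushᵍ f (x ∷ u))
      ≈⟨ T.lin-single ∂ᵛ (Vec.map (map f) (x ∷ u)) ⟩
    ∂ᵛ (Vec.map (map f) (x ∷ u))
      ≈⟨ ∂ᵛ-map (map f) (x ∷ u) ⟩
    push f (∂ᵛ (x ∷ u))
      ≈⟨ relabel-cong (Vec.map (map f)) (∂ᵛ-cons x u) ⟩
    push f (((1# , u) ∷ []) ⊕ neg (x ◃ ∂ᵛ u))
      ≈⟨ T.lin-⊕ (pushᵍ f) ((1# , u) ∷ []) (neg (x ◃ ∂ᵛ u)) ⟩
    push f ((1# , u) ∷ []) ⊕ push f (neg (x ◃ ∂ᵛ u))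
      ≈⟨ T.⊕-cong (T.lin-single (pushᵍ f) u) (T.lin-scale (pushᵍ f) (- 1#) (x ◃ ∂ᵛ u)) ⟩
    pushᵍ f u ⊕ neg (push f (x ◃ ∂ᵛ u)) ∎
    where open T.≋-Reasoning {suc k}

  AllowedOrNonRegular : ∀ {k} → Vec V k → Set
  AllowedOrNonRegular w = Allowed w ⊎ NonRegular w

  ∷-allowedOrNonRegular : ∀ {k a} {w : Vec V (suc k)} → EqOrAdj a (Vec.head w) →
                          AllowedOrNonRegular w → AllowedOrNonRegular (a ∷ w)
  ∷-allowedOrNonRegular {w = b ∷ w} (inj₁ a≡b) _                = inj₂ (inj₁ a≡b)
  ∷-allowedOrNonRegular {w = b ∷ w} (inj₂ ab)  (inj₁ allowed)    = inj₁ (ab , allowed)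
  ∷-allowedOrNonRegular {w = b ∷ w} (inj₂ _)   (inj₂ nonRegular) = inj₂ (inj₂ nonRegular)

  ∷-nonRegular : ∀ {k a} {w : Vec V (suc k)} → NonRegular w → NonRegular (a ∷ w)
  ∷-nonRegular {w = b ∷ w} = inj₂

  ≡head⇒nonRegular : ∀ {k a} {w : Vec V (suc k)} → a ≡ Vec.head w → NonRegular (a ∷ w)
  ≡head⇒nonRegular {w = b ∷ w} = inj₁

  map-allowedOrNonRegular : ∀ {k} (f : Endo) (v : Vec V k) → Allowed v → AllowedOrNonRegular (Vec.map (map f) v)
  map-allowedOrNonRegular f []          _          = inj₁ tt
  map-allowedOrNonRegular f (x ∷ [])    _          = inj₁ tt
  map-allowedOrNonRegular f (x ∷ y ∷ v) (xy , yv) =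
    ∷-allowedOrNonRegular (map-hom f (inj₂ xy)) (map-allowedOrNonRegular f (y ∷ v) yv)

  map-nonRegular : ∀ {k} (f : Endo) (v : Vec V k) → NonRegular v → NonRegular (Vec.map (map f) v)
  map-nonRegular f (x ∷ y ∷ v) (inj₁ x≡y)         = inj₁ (≡.cong (map f) x≡y)
  map-nonRegular f (x ∷ y ∷ v) (inj₂ yv-nonRegular) = inj₂ (map-nonRegular f (y ∷ v) yv-nonRegular)

  ◃-span : ∀ {k} {P : Vec V k → Set} {Q : Vec V (suc k) → Set} (a : V) →
           (∀ w → P w → Q (a ∷ w)) → ∀ {c} → InSpan P c → InSpan Q (a ◃ c)
  ◃-span a P⇒Q = InSpan-lin (λ w → (1# , a ∷ w) ∷ []) (λ w Pw → P⇒Q w Pw ∷ [])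

  ◃-head : ∀ {k} (a : V) (c : Chain (Vec V k)) → InSpan (λ w → Vec.head w ≡ a) (a ◃ c)
  ◃-head a = InSpan-lin-total (λ w → (1# , a ∷ w) ∷ []) (λ w → ≡.refl ∷ [])

  ≈V⇒≈ₘ : ∀ {n} {x y : PChain n} → x ≈V y → x Tₘ.≈ₘ y
  ≈V⇒≈ₘ (d , d∈span , x≈y⊕d) = Tₘ.modulo d d∈span (T.coeffwise x≈y⊕d)

  ≈ₘ⇒≈V : ∀ {n} {x y : PChain n} → x Tₘ.≈ₘ y → x ≈V y
  ≈ₘ⇒≈V (Tₘ.modulo d d∈span x≋y⊕d) = d , d∈span , T.coeff-≈ x≋y⊕d

  InÃₘ : ∀ {k} → Chain (Vec V k) → Set (c ⊔ ℓ)
  InÃₘ x = ∃[ a ] (InSpan Allowed a × x Tₘ.≈ₘ a)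

  InÃ⇒InÃₘ : ∀ {n} {x : PChain n} → InÃ x → InÃₘ x
  InÃ⇒InÃₘ (a , a-allowed , x≈a) = a , a-allowed , ≈V⇒≈ₘ x≈a

  InÃₘ⇒InÃ : ∀ {n} {x : PChain n} → InÃₘ x → InÃ x
  InÃₘ⇒InÃ (a , a-allowed , x≈a) = a , a-allowed , ≈ₘ⇒≈V x≈a

  InÃₘ-⊕ : ∀ {k} {x y : Chain (Vec V k)} → InÃₘ x → InÃₘ y → InÃₘ (x ⊕ y)
  InÃₘ-⊕ (a , a-allowed , x≈a) (b , b-allowed , y≈b) =
    a ⊕ b , InSpan-⊕ a-allowed b-allowed , Tₘ.⊕-congₘ x≈a y≈b

  module Prism {f g : Endo} (H : OneStepHomotopy f g) where

    -- prism (x₀ … xₖ) = Σᵢ (−1)ⁱ (g x₀, …, g xᵢ, f xᵢ, …, f xₖ), unfolded along the first vertex.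
    prism : ∀ {k} → Vec V k → Chain (Vec V (suc k))
    prism []      = []
    prism (x ∷ u) = map g x ◃ (pushᵍ f (x ∷ u) ⊕ neg (prism u))

    prism-resp : ∀ {k} {v w : Vec V k} → v ≡ w → prism v T.≋ prism w
    prism-resp ≡.refl = T.≋-refl

    prism-cone : ∀ {k} (a : V) (c : Chain (Vec V k)) →
                 lin prism (a ◃ c) T.≋ map g a ◃ (push f (a ◃ c) ⊕ neg (lin prism c))
    prism-cone {k} a c = begin
      lin prism (a ◃ c)
        ≈⟨ T.lin-relabel prism (a ∷_) c ⟩
      lin (λ u → map g a ◃ (pushᵍ f (a ∷ u) ⊕ neg (prism u))) c
        ≈⟨ T.lin-lin (λ u → (1# , map g a ∷ u) ∷ []) W c ⟨
      map g a ◃ lin W c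
        ≈⟨ ◃-cong (map g a) (T.lin-pointwise-⊕ (pushᵍ f ∘ (a ∷_)) (neg ∘ prism) c) ⟩
      map g a ◃ (lin (pushᵍ f ∘ (a ∷_)) c ⊕ lin (neg ∘ prism) c)
        ≈⟨ ◃-cong (map g a) (T.⊕-cong (T.≋-sym (T.lin-relabel (pushᵍ f) (a ∷_) c))
           (T.lin-pointwise-neg prism c)) ⟩
      map g a ◃ (push f (a ◃ c) ⊕ neg (lin prism c)) ∎
      where
      open T.≋-Reasoning {suc (suc k)}
      W : Vec V k → Chain (Vec V (suc k))
      W u = pushᵍ f (a ∷ u) ⊕ neg (prism u)

    prism-∂ᵛ-cons : ∀ {k} (x : V) (u : Vec V (suc k)) →
                    lin prism (∂ᵛ (x ∷ u)) T.≋
                    prism u ⊕ neg (map g x ◃ (push f (x ◃ ∂ᵛ u) ⊕ neg (lin prism (∂ᵛ u))))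
    prism-∂ᵛ-cons {k} x u = begin
      lin prism (∂ᵛ (x ∷ u))
        ≈⟨ lin-resp prism prism-resp (∂ᵛ-cons x u) ⟩
      lin prism (((1# , u) ∷ []) ⊕ neg (x ◃ ∂ᵛ u))
        ≈⟨ T.lin-⊕ prism ((1# , u) ∷ []) (neg (x ◃ ∂ᵛ u)) ⟩
      lin prism ((1# , u) ∷ []) ⊕ lin prism (neg (x ◃ ∂ᵛ u))
        ≈⟨ T.⊕-cong (T.lin-single prism u) (T.lin-scale prism (- 1#) (x ◃ ∂ᵛ u)) ⟩
      prism u ⊕ neg (lin prism (x ◃ ∂ᵛ u))
        ≈⟨ T.⊕-cong (T.≋-refl {x = prism u}) (T.neg-cong (prism-cone x (∂ᵛ u))) ⟩
      prism u ⊕ neg (map g x ◃ (push f (x ◃ ∂ᵛ u) ⊕ neg (lin prism (∂ᵛ u)))) ∎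
      where open T.≋-Reasoning {suc (suc k)}

    -- With prism (x ∷ u) = g x ◃ W, this is the chain under g x ◃ in ∂ prism (x ∷ u) + prism ∂ (x ∷ u):
    -- the terms f (x ◃ ∂u) cancel and the homotopy identity for u leaves g u.
    cone-base-boundary : ∀ {k} (x : V) (u : Vec V (suc k)) →
      lin ∂ᵛ (prism u) ⊕ lin prism (∂ᵛ u) T.≋ pushᵍ f u ⊕ neg (pushᵍ g u) →
      lin ∂ᵛ (pushᵍ f (x ∷ u) ⊕ neg (prism u)) ⊕ (push f (x ◃ ∂ᵛ u) ⊕ neg (lin prism (∂ᵛ u)))
        T.≋ pushᵍ g u
    cone-base-boundary {k} x u homotopy-u = begin
      lin ∂ᵛ (pushᵍ f (x ∷ u) ⊕ neg (prism u)) ⊕ (X ⊕ neg P∂u)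
        ≈⟨ T.⊕-cong (T.lin-⊕ ∂ᵛ (pushᵍ f (x ∷ u)) (neg (prism u))) (T.≋-refl {x = X ⊕ neg P∂u}) ⟩
      (lin ∂ᵛ (pushᵍ f (x ∷ u)) ⊕ lin ∂ᵛ (neg (prism u))) ⊕ (X ⊕ neg P∂u)
        ≈⟨ T.⊕-cong (T.⊕-cong (∂-pushᵍ f x u) (T.lin-scale ∂ᵛ (- 1#) (prism u)))
                    (T.≋-refl {x = X ⊕ neg P∂u}) ⟩
      ((pushᵍ f u ⊕ neg X) ⊕ neg ∂Pu) ⊕ (X ⊕ neg P∂u)
        ≈⟨ T.⊕-neg-interchange (pushᵍ f u ⊕ neg X) ∂Pu X P∂u ⟩
      ((pushᵍ f u ⊕ neg X) ⊕ X) ⊕ neg (∂Pu ⊕ P∂u)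
        ≈⟨ T.⊕-cong (T.⊕-neg-cancelʳ (pushᵍ f u) X) (T.neg-cong homotopy-u) ⟩
      pushᵍ f u ⊕ neg (pushᵍ f u ⊕ neg (pushᵍ g u))
        ≈⟨ T.x⊕neg[x⊕neg-y]≋y (pushᵍ f u) (pushᵍ g u) ⟩
      pushᵍ g u ∎
      where
      open T.≋-Reasoning {suc k}
      X P∂u ∂Pu : Chain (Vec V (suc k))
      X   = push f (x ◃ ∂ᵛ u)
      P∂u = lin prism (∂ᵛ u)
      ∂Pu = lin ∂ᵛ (prism u)

    prism-homotopy : ∀ {k} (v : Vec V (suc k)) →
                     lin ∂ᵛ (prism v) ⊕ lin prism (∂ᵛ v) T.≋ pushᵍ f v ⊕ neg (pushᵍ g v)
    prism-homotopy (x ∷ []) = begin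
      lin ∂ᵛ (prism (x ∷ [])) ⊕ []
        ≈⟨ T.⊕-identityʳ _ ⟩
      lin ∂ᵛ (map g x ◃ pushᵍ f (x ∷ []))
        ≈⟨ ∂-cone (map g x) (pushᵍ f (x ∷ [])) ⟩
      pushᵍ f (x ∷ []) ⊕ neg (map g x ◃ lin ∂ᵛ (pushᵍ f (x ∷ [])))
        ≈⟨ T.⊕-cong (T.≋-refl {x = pushᵍ f (x ∷ [])})
           (T.neg-cong (T.cons-cong (trans (*-identityʳ _) (*-identityʳ _)) ≡.refl T.≋-refl)) ⟩
      pushᵍ f (x ∷ []) ⊕ neg (pushᵍ g (x ∷ [])) ∎
      where open T.≋-Reasoning {1}
    prism-homotopy {suc k} (x ∷ u@(_ ∷ _)) = begin
      lin ∂ᵛ (prism (x ∷ u)) ⊕ lin prism (∂ᵛ (x ∷ u))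
        ≈⟨ T.⊕-cong (∂-cone a W) (prism-∂ᵛ-cons x u) ⟩
      (W ⊕ neg (a ◃ lin ∂ᵛ W)) ⊕ (prism u ⊕ neg (a ◃ Y))
        ≈⟨ T.⊕-neg-interchange W (a ◃ lin ∂ᵛ W) (prism u) (a ◃ Y) ⟩
      (W ⊕ prism u) ⊕ neg (a ◃ lin ∂ᵛ W ⊕ a ◃ Y)
        ≈⟨ T.⊕-cong (T.⊕-neg-cancelʳ (pushᵍ f (x ∷ u)) (prism u))
                    (T.neg-cong (T.≋-sym (T.lin-⊕ (λ w → (1# , a ∷ w) ∷ []) (lin ∂ᵛ W) Y))) ⟩
      pushᵍ f (x ∷ u) ⊕ neg (a ◃ (lin ∂ᵛ W ⊕ Y))
        ≈⟨ T.⊕-cong (T.≋-refl {x = pushᵍ f (x ∷ u)})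
                    (T.neg-cong (◃-cong a (cone-base-boundary x u (prism-homotopy u)))) ⟩
      pushᵍ f (x ∷ u) ⊕ neg (a ◃ pushᵍ g u)
        ≈⟨ T.⊕-cong (T.≋-refl {x = pushᵍ f (x ∷ u)})
                    (T.neg-cong (T.cons-cong (*-identityʳ _) ≡.refl T.≋-refl)) ⟩
      pushᵍ f (x ∷ u) ⊕ neg (pushᵍ g (x ∷ u)) ∎
      where
      open T.≋-Reasoning {suc (suc k)}
      a : V
      a = map g x
      W : Chain (Vec V (suc (suc k)))
      W = pushᵍ f (x ∷ u) ⊕ neg (prism u)
      Y : Chain (Vec V (suc k))
      Y = push f (x ◃ ∂ᵛ u) ⊕ neg (lin prism (∂ᵛ u))

    prism-head : ∀ {k} (v : Vec V (suc k)) → InSpan (λ w → Vec.head w ≡ map g (Vec.head v)) (prism v)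
    prism-head (x ∷ u) = ◃-head (map g x) (pushᵍ f (x ∷ u) ⊕ neg (prism u))

    prism-nonRegular : ∀ {k} (v : Vec V k) → NonRegular v → InSpan NonRegular (prism v)
    prism-nonRegular v@(x ∷ y ∷ u) (inj₁ x≡y) =
      ◃-span (map g x) (λ _ nonRegular → nonRegular)
        (InSpan-⊕ (inj₂ (inj₁ (≡.cong (map f) x≡y)) ∷ [])
                  (InSpan-scale (- 1#) (InSpan-map gx≡head (prism-head (y ∷ u)))))
      where
      gx≡head : ∀ {n} (w : Vec V (suc n)) → Vec.head w ≡ map g y → NonRegular (map g x ∷ w)
      gx≡head w head≡gy = ≡head⇒nonRegular (≡.trans (≡.cong (map g) x≡y) (≡.sym head≡gy))
    prism-nonRegular v@(x ∷ y ∷ u) (inj₂ yu-nonRegular) =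
      ◃-span (map g x) (λ _ → ∷-nonRegular)
        (InSpan-⊕ (map-nonRegular f v (inj₂ yu-nonRegular) ∷ [])
                  (InSpan-scale (- 1#) (prism-nonRegular (y ∷ u) yu-nonRegular)))

    prism-allowedOrNonRegular : ∀ {k} (v : Vec V (suc k)) → Allowed v → InSpan AllowedOrNonRegular (prism v)
    prism-allowedOrNonRegular (x ∷ []) _ =
      ∷-allowedOrNonRegular {w = map f x ∷ []} (EqOrAdj-sym E-sym (H x)) (inj₁ tt) ∷ []
    prism-allowedOrNonRegular v@(x ∷ y ∷ u) (xy , yu) =
      ◃-span (map g x) (λ _ ok → ok)
        (InSpan-⊕ (∷-allowedOrNonRegular (EqOrAdj-sym E-sym (H x)) (map-allowedOrNonRegular f v (xy , yu)) ∷ [])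
                  (InSpan-scale (- 1#) (All.zipWith gx∷ (prism-allowedOrNonRegular (y ∷ u) yu , prism-head (y ∷ u)))))
      where
      gx≃gy : EqOrAdj (map g x) (map g y)
      gx≃gy = map-hom g (inj₂ xy)
      gx∷ : ∀ {n} {w : Vec V (suc n)} → AllowedOrNonRegular w × Vec.head w ≡ map g y →
            AllowedOrNonRegular (map g x ∷ w)
      gx∷ (ok , head≡gy) = ∷-allowedOrNonRegular (≡.subst (EqOrAdj (map g x)) (≡.sym head≡gy) gx≃gy) ok

    prism-InÃₘ : ∀ {k} {x : Chain (Vec V (suc k))} → InÃₘ x → InÃₘ (lin prism x)
    prism-InÃₘ (a , a-allowed , x≈a) with Tₘ.InSpan-⊎⇒≈ₘ (InSpan-lin prism prism-allowedOrNonRegular a-allowed)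
    ... | b , b-allowed , Pa≈b =
      b , b-allowed , Tₘ.≈ₘ-trans (lin-respₘ prism prism-resp prism-nonRegular x≈a) Pa≈b

    push-homotopy : ∀ {m} (x : PChain (suc m)) → ∂ x Tₘ.≈ₘ [] →
                    push f x Tₘ.≈ₘ ∂ (lin prism x) ⊕ push g x
    push-homotopy {m} x = chainHomotopy-onCycles
      {tuples (suc m)} {tuples (suc (suc m))} {tuples (suc (suc (suc m)))} {NonRegular} {NonRegular}
      ∂ᵛ ∂ᵛ prism prism (pushᵍ f) (pushᵍ g) prism-homotopy prism-resp prism-nonRegular x

  push-homotopic : ∀ {f g} → Homotopic f g → ∀ {m} (x : PChain (suc m)) → InÃₘ x → ∂ x Tₘ.≈ₘ [] →
                   ∃[ w ] (InÃₘ w × push f x Tₘ.≈ₘ ∂ w ⊕ push g x)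
  push-homotopic homotopic-refl x x∈Ã x-cycle = [] , ([] , [] , Tₘ.≈ₘ-refl) , Tₘ.≈ₘ-refl
  push-homotopic {f} (homotopic-step {g = g} f≃₁g g≃h) x x∈Ã x-cycle with push-homotopic g≃h x x∈Ã x-cycle
  ... | w , w∈Ã , gx≈∂w+hx =
    lin prism x ⊕ w , InÃₘ-⊕ (prism-InÃₘ x∈Ã) w∈Ã ,
    Tₘ.≈ₘ-∂-trans ∂ᵛ (lin prism x) w (push-homotopy x x-cycle) gx≈∂w+hx
    where open Prism {f} {g} f≃₁g

  constant-nonRegular : ∀ {k} v₀ (w : Vec V (suc (suc k))) → NonRegular (Vec.map (map (constᴱ v₀)) w)
  constant-nonRegular v₀ (x ∷ y ∷ w) = inj₁ ≡.refl

  contractible⇒pathHomologyVanishes : Contractible → ∀ m → PathHomologyVanishes (suc m)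
  contractible⇒pathHomologyVanishes (v₀ , id≃const) m x (x∈Ã , _) x-cycle =
    w , (InÃₘ⇒InÃ w∈Ã , InÃₘ⇒InÃ ∂w∈Ã) , ≈ₘ⇒≈V (Tₘ.≈ₘ-sym x≈∂w)
    where
    homotopic : ∃[ w ] (InÃₘ w × push idᴱ x Tₘ.≈ₘ ∂ w ⊕ push (constᴱ v₀) x)
    homotopic = push-homotopic id≃const x (InÃ⇒InÃₘ x∈Ã) (≈V⇒≈ₘ x-cycle)
    w : PChain (suc (suc m))
    w = proj₁ homotopic
    w∈Ã : InÃₘ w
    w∈Ã = proj₁ (proj₂ homotopic)
    constant≈ₘ[] : push (constᴱ v₀) x Tₘ.≈ₘ []
    constant≈ₘ[] = Tₘ.span≈ₘ[]
      (InSpan-lin-total (pushᵍ (constᴱ v₀)) (λ v → constant-nonRegular v₀ v ∷ []) x)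
    x≈∂w : x Tₘ.≈ₘ ∂ w
    x≈∂w = begin
      x                             ≈⟨ Tₘ.≋⇒≈ₘ (T.≋-sym (push-id x)) ⟩
      push idᴱ x                    ≈⟨ proj₂ (proj₂ homotopic) ⟩
      ∂ w ⊕ push (constᴱ v₀) x      ≈⟨ Tₘ.⊕-congₘ (Tₘ.≈ₘ-refl {x = ∂ w}) constant≈ₘ[] ⟩
      ∂ w ⊕ []                      ≈⟨ Tₘ.≋⇒≈ₘ (T.⊕-identityʳ (∂ w)) ⟩
      ∂ w                           ∎
      where open Tₘ.≈ₘ-Reasoning
    ∂w∈Ã : InÃₘ (∂ w)
    ∂w∈Ã with InÃ⇒InÃₘ x∈Ã
    ... | a , a-allowed , x≈a = a , a-allowed , Tₘ.≈ₘ-trans (Tₘ.≈ₘ-sym x≈∂w) x≈a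

KE-sym : ∀ {s t} → Symmetric (KE {s} {t})
KE-sym {x = inj₁ _} {inj₂ _} _ = tt
KE-sym {x = inj₂ _} {inj₁ _} _ = tt

module CompleteBipartite (s t : ℕ) where
  open Graph (K (suc s) (suc t))
  open Endomorphisms (K (suc s) (suc t))

  a₀ b₀ : V
  a₀ = inj₁ zero
  b₀ = inj₂ zero

  fold : V → V
  fold (inj₁ zero)    = a₀
  fold (inj₁ (suc _)) = b₀
  fold (inj₂ zero)    = b₀
  fold (inj₂ (suc _)) = a₀

  OnEdge : V → Set
  OnEdge v = v ≡ a₀ ⊎ v ≡ b₀

  onEdge-EqOrAdj : ∀ {u v} → OnEdge u → OnEdge v → EqOrAdj u v
  onEdge-EqOrAdj (inj₁ ≡.refl) (inj₁ ≡.refl) = inj₁ ≡.refl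
  onEdge-EqOrAdj (inj₁ ≡.refl) (inj₂ ≡.refl) = inj₂ tt
  onEdge-EqOrAdj (inj₂ ≡.refl) (inj₁ ≡.refl) = inj₂ tt
  onEdge-EqOrAdj (inj₂ ≡.refl) (inj₂ ≡.refl) = inj₁ ≡.refl

  fold-onEdge : ∀ v → OnEdge (fold v)
  fold-onEdge (inj₁ zero)    = inj₁ ≡.refl
  fold-onEdge (inj₁ (suc _)) = inj₂ ≡.refl
  fold-onEdge (inj₂ zero)    = inj₂ ≡.refl
  fold-onEdge (inj₂ (suc _)) = inj₁ ≡.refl

  foldᴱ : Endo
  foldᴱ = endo fold (λ {u} {v} _ → onEdge-EqOrAdj (fold-onEdge u) (fold-onEdge v))

  id≃₁fold : OneStepHomotopy idᴱ foldᴱ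
  id≃₁fold (inj₁ zero)    = inj₁ ≡.refl
  id≃₁fold (inj₁ (suc _)) = inj₂ tt
  id≃₁fold (inj₂ zero)    = inj₁ ≡.refl
  id≃₁fold (inj₂ (suc _)) = inj₂ tt

  fold≃₁const : OneStepHomotopy foldᴱ (constᴱ a₀)
  fold≃₁const v = onEdge-EqOrAdj (fold-onEdge v) (inj₁ ≡.refl)

  contractible : Contractible
  contractible = a₀ , homotopic-step {g = foldᴱ} id≃₁fold (homotopic-step fold≃₁const homotopic-refl)

corollary4p5 : ∀ {c ℓ : Level} (R : CommutativeRing c ℓ) (s t : ℕ) → 0 < s → 0 < t →
    (n : ℕ) → 0 < n →
    PathH.PathHomologyVanishes R (K s t) n × Cubical.CubeHomologyVanishes R (K s t) n
corollary4p5 R (suc s) (suc t) (s≤s z≤n) (s≤s z≤n) (suc m) (s≤s z≤n) =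
  PathHomotopy.contractible⇒pathHomologyVanishes R (K (suc s) (suc t)) KE-sym K-contractible m ,
  CubicalHomotopy.contractible⇒cubeHomologyVanishes R (K (suc s) (suc t)) KE-sym K-contractible m
  where
  K-contractible : Endomorphisms.Contractible (K (suc s) (suc t))
  K-contractible = CompleteBipartite.contractible s t
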